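{- Let $\Gamma$ be a set of first-order sentences and let $\Pi$ be a Lloyd–Topor program that is tight relative to $\Gamma$ ($\Gamma$-tight). Then $$\Gamma\models \mathrm{SM}[\Pi]\leftrightarrow \mathrm{Comp}[\Pi],$$ i.e. every interpretation satisfying all sentences of $\Gamma$ satisfies $\mathrm{SM}[\Pi]\leftrightarrow\mathrm{Comp}[\Pi]$.
   Context: Formulas are first-order formulas (with equality) built from atomic formulas and $\bot$ using $\land,\lor,\rightarrow,\forall,\exists$; $\neg F$ abbreviates $F\rightarrow\bot$, $\top$ abbreviates $\bot\rightarrow\bot$, $F\leftrightarrow G$ abbreviates $(F\rightarrow G)\land(G\rightarrow F)$; $\widetilde\forall F$ is the universal closure of $F$. Interpretations are arbitrary first-order interpretations (not necessarily Herbrand), and $\models$ is ordinary first-order entailment. A Lloyd–Topor program is a finite set of rules $p(\mathbf t)\leftarrow G$, where $p$ is a predicate constant other than equality, $\mathbf t$ is a tuple of terms and $G$ is a formula (the body). The program is identified with the sentence that is the conjunction of $\widetilde\forall(G\rightarrow p(\mathbf t))$ over its rules. Completion: for a predicate constant $p$ (not equality), let $p(\mathbf t^i)\leftarrow G^i$ ($i=1,\dots,m$) be all rules of $\Pi$ with $p$ in the head. The completed definition of $p$ in $\Pi$ is $\forall\mathbf x\,(p(\mathbf x)\leftrightarrow\bigvee_i\exists\mathbf y^i(\mathbf x=\mathbf t^i\land G^i))$, where $\mathbf x$ is a tuple of distinct variables not occurring in these rules, $\mathbf y^i$ is the list of free variables of the $i$-th rule, and $\mathbf x=\mathbf t^i$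 is the conjunction of equalities between corresponding members (an empty disjunction is $\bot$). $\mathrm{Comp}[\Pi]$ is the conjunction of the completed definitions of all predicate constants (other than equality) occurring in $\Pi$. Operator SM: for a sentence $F$ and a tuple $\mathbf p=p_1,\dots,p_n$ of distinct predicate constants (not equality), let $\mathbf u=u_1,\dots,u_n$ be distinct predicate variables with the same arities. Define $F^*(\mathbf u)$ recursively: $p_i(\mathbf t)^*=u_i(\mathbf t)$; $A^*=A$ for any other atomic formula $A$ (including equalities); $\bot^*=\bot$; $(F\land G)^*=F^*\land G^*$; $(F\lor G)^*=F^*\lor G^*$; $(F\rightarrow G)^*=(F^*\rightarrow G^*)\land(F\rightarrow G)$; $(\forall x F)^*=\forall xF^*$; $(\exists xF)^*=\exists xF^*$. Let $\mathbf u\le\mathbf p$ be $\bigwedge_i\forall\mathbf x(u_i(\mathbf x)\rightarrow p_i(\mathbf x))$ and $\mathbf u<\mathbf p$ be $(\mathbf u\le\mathbf p)\land\neg(\mathbf p\le\mathbf u)$. Then $\mathrm{SM}_{\mathbf p}[F]$ is the second-order sentence $F\land\neg\exists\mathbf u((\mathbf u<\mathbf p)\land F^*(\mathbf u))$. $\mathrm{SM}[F]$ denotes $\mathrm{SM}_{\mathbf p}[F]$ with $\mathbf p$ the list of all predicate constants (other than equality) occurring in $F$. An occurrence of an expression in a formula is negated if it belongs to a subformula of the form $F\rightarrow\bot$, nonnegated otherwise; it is positive if the number of implications containing that occurrence in their antecedent is even. Rule dependency graph of $\Pi$: its vertices are the rules of $\Pi$ with variables (free and bound) renamed arbitrarily;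 there is an edge from a vertex $p(\mathbf t)\leftarrow G$ to a vertex $p'(\mathbf t')\leftarrow G'$, labeled by an atomic formula $p'(\mathbf s)$, whenever $p'(\mathbf s)$ has a positive nonnegated occurrence in $G$. A chain is a finite path in this graph whose rules pairwise have no common variables (free or bound); its length is the number of edges. For a chain $C$ consisting of rules $p_i(\mathbf t^i)\leftarrow \mathit{Body}_i$ ($i=0,\dots,n$) with the edge from the $(i-1)$-th to the $i$-th rule labeled $p_i(\mathbf s^i)$ ($i=1,\dots,n$), the chain formula is $F_C=\bigwedge_{i=1}^n\mathbf s^i=\mathbf t^i\land\bigwedge_{i=0}^n\mathit{Body}_i$. Given a set $\Gamma$ of sentences, $\Pi$ is tight relative to $\Gamma$ ($\Gamma$-tight) if there is a positive integer $n$ such that for every chain $C$ in $\Pi$ of length $n$, $\Gamma,\mathrm{Comp}[\Pi]\models\widetilde\forall\neg F_C$. -}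

module Defs where

open import Data.Nat using (ℕ; zero; suc; _+_; _⊔_)
import Data.Nat
open import Data.Nat.Properties using () renaming (_≟_ to _≟ℕ_)
open import Data.Bool using (Bool; true; false; not)
open import Data.Fin using (Fin; zero; suc; inject₁; toℕ)
open import Data.Vec using (Vec; []; _∷_; toList)
import Data.Vec as V
open import Data.List using (List; []; _∷_; _++_; filter; foldr; concat; concatMap; deduplicate)
import Data.List as L
open import Data.List.Membership.Propositional using (_∈_)
open import Data.List.Relation.Unary.All using (All)
open import Data.Product using (Σ; _×_; _,_)
open import Data.Sum using (_⊎_; inj₁; inj₂)
open import Data.Empty using () renaming (⊥ to Empty)
open import Relation.Nullary using (¬_; yes; no; ¬?)
open import Relation.Binary.PropositionalEquality using (_≡_; _≢_; subst)
open import Relation.Binary using (DecidableEquality)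

-- Equality is
-- NOT a predicate constant: it is a separate atomic-formula former.

record Signature : Set₁ where
  field
    Fn   : Set
    fa   : Fn → ℕ
    Pr   : Set
    pa   : Pr → ℕ
    _≟P_ : DecidableEquality Pr

_[_↦_] : {A : Set} → (ℕ → A) → ℕ → A → ℕ → A
(f [ x ↦ a ]) y with y ≟ℕ x
... | yes _ = a
... | no  _ = f y

dedupℕ : List ℕ → List ℕ
dedupℕ = deduplicate _≟ℕ_

removeℕ : ℕ → List ℕ → List ℕ
removeℕ x = filter (λ y → ¬? (y ≟ℕ x))

module _ (S : Signature) where
  open Signature S

  data Term : Set where
    var : ℕ → Term
    app : (f : Fn) → Vec Term (fa f) → Term

  mutual
    tvars : Term → List ℕ
    tvars (var x)    = x ∷ []
    tvars (app f ts) = tsvars ts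

    tsvars : ∀ {n} → Vec Term n → List ℕ
    tsvars []       = []
    tsvars (t ∷ ts) = tvars t ++ tsvars ts

  mutual
    renT : (ℕ → ℕ) → Term → Term
    renT ρ (var x)    = var (ρ x)
    renT ρ (app f ts) = app f (renTs ρ ts)

    renTs : ∀ {n} → (ℕ → ℕ) → Vec Term n → Vec Term n
    renTs ρ []       = []
    renTs ρ (t ∷ ts) = renT ρ t ∷ renTs ρ ts

  -- Formulas, over an arbitrary set Q of predicate symbols with arities
  -- qa (used with Q = Pr for ordinary formulas, and with Q = Pr ⊎ Pr for
  -- formulas F*(u) that also mention the predicate variables u_p).

  data Formula (Q : Set) (qa : Q → ℕ) : Set where
    atom  : (q : Q) → Vec Term (qa q) → Formula Q qa
    _≐_   : Term → Term → Formula Q qa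
    ⊥ᶠ    : Formula Q qa
    _∧ᶠ_  : Formula Q qa → Formula Q qa → Formula Q qa
    _∨ᶠ_  : Formula Q qa → Formula Q qa → Formula Q qa
    _⇒ᶠ_  : Formula Q qa → Formula Q qa → Formula Q qa
    ∀ᶠ    : ℕ → Formula Q qa → Formula Q qa
    ∃ᶠ    : ℕ → Formula Q qa → Formula Q qa

  Fm : Set
  Fm = Formula Pr pa

  ¬ᶠ : {Q : Set} {qa : Q → ℕ} → Formula Q qa → Formula Q qa
  ¬ᶠ F = F ⇒ᶠ ⊥ᶠ

  ⊤ᶠ : {Q : Set} {qa : Q → ℕ} → Formula Q qa
  ⊤ᶠ = ⊥ᶠ ⇒ᶠ ⊥ᶠ

  _⇔ᶠ_ : {Q : Set} {qa : Q → ℕ} → Formula Q qa → Formula Q qa → Formula Q qa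
  F ⇔ᶠ G = (F ⇒ᶠ G) ∧ᶠ (G ⇒ᶠ F)

  conj : List Fm → Fm
  conj []           = ⊤ᶠ
  conj (F ∷ [])     = F
  conj (F ∷ G ∷ Fs) = F ∧ᶠ conj (G ∷ Fs)

  disj : List Fm → Fm
  disj []           = ⊥ᶠ
  disj (F ∷ [])     = F
  disj (F ∷ G ∷ Fs) = F ∨ᶠ disj (G ∷ Fs)

  fv : {Q : Set} {qa : Q → ℕ} → Formula Q qa → List ℕ
  fv (atom q ts) = tsvars ts
  fv (t ≐ s)     = tvars t ++ tvars s
  fv ⊥ᶠ          = []
  fv (F ∧ᶠ G)    = fv F ++ fv G
  fv (F ∨ᶠ G)    = fv F ++ fv G
  fv (F ⇒ᶠ G)    = fv F ++ fv G
  fv (∀ᶠ x F)    = removeℕ x (fv F)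
  fv (∃ᶠ x F)    = removeℕ x (fv F)

  allvars : {Q : Set} {qa : Q → ℕ} → Formula Q qa → List ℕ
  allvars (atom q ts) = tsvars ts
  allvars (t ≐ s)     = tvars t ++ tvars s
  allvars ⊥ᶠ          = []
  allvars (F ∧ᶠ G)    = allvars F ++ allvars G
  allvars (F ∨ᶠ G)    = allvars F ++ allvars G
  allvars (F ⇒ᶠ G)    = allvars F ++ allvars G
  allvars (∀ᶠ x F)    = x ∷ allvars F
  allvars (∃ᶠ x F)    = x ∷ allvars F

  preds : Fm → List Pr
  preds (atom p ts) = p ∷ []
  preds (t ≐ s)     = []
  preds ⊥ᶠ          = []
  preds (F ∧ᶠ G)    = preds F ++ preds G
  preds (F ∨ᶠ G)    = preds F ++ preds G
  preds (F ⇒ᶠ G)    = preds F ++ preds G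
  preds (∀ᶠ x F)    = preds F
  preds (∃ᶠ x F)    = preds F

  Sentence : Fm → Set
  Sentence F = fv F ≡ []

  foralls : List ℕ → Fm → Fm
  foralls xs F = foldr ∀ᶠ F xs

  exists : List ℕ → Fm → Fm
  exists xs F = foldr ∃ᶠ F xs

  closure : Fm → Fm
  closure F = foralls (dedupℕ (fv F)) F

  record Structure : Set₁ where
    field
      D    : Set
      d₀   : D
      funI : (f : Fn) → Vec D (fa f) → D
      relI : (p : Pr) → Vec D (pa p) → Set

  module _ (M : Structure) where
    open Structure M

    mutual
      evalT : (ℕ → D) → Term → D
      evalT ρ (var x)    = ρ x
      evalT ρ (app f ts) = funI f (evalTs ρ ts)

      evalTs : ∀ {n} → (ℕ → D) → Vec Term n → Vec D n
      evalTs ρ []       = []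
      evalTs ρ (t ∷ ts) = evalT ρ t ∷ evalTs ρ ts

    evalF : {Q : Set} {qa : Q → ℕ} → ((q : Q) → Vec D (qa q) → Set)
          → (ℕ → D) → Formula Q qa → Set
    evalF R ρ (atom q ts) = R q (evalTs ρ ts)
    evalF R ρ (t ≐ s)     = evalT ρ t ≡ evalT ρ s
    evalF R ρ ⊥ᶠ          = Empty
    evalF R ρ (F ∧ᶠ G)    = evalF R ρ F × evalF R ρ G
    evalF R ρ (F ∨ᶠ G)    = evalF R ρ F ⊎ evalF R ρ G
    evalF R ρ (F ⇒ᶠ G)    = evalF R ρ F → evalF R ρ G
    evalF R ρ (∀ᶠ x F)    = (d : D) → evalF R (ρ [ x ↦ d ]) F
    evalF R ρ (∃ᶠ x F)    = Σ D (λ d → evalF R (ρ [ x ↦ d ]) F)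

  -- M ⊨ F  (for sentences: truth; in general: truth of the universal closure)
  Sat : Structure → Fm → Set
  Sat M F = (ρ : ℕ → Structure.D M) → evalF M (Structure.relI M) ρ F

  paU : Pr ⊎ Pr → ℕ
  paU (inj₁ p) = pa p
  paU (inj₂ p) = pa p

  -- inj₁ p : the predicate constant p ;  inj₂ p : the predicate variable u_p
  embed : Fm → Formula (Pr ⊎ Pr) paU
  embed (atom p ts) = atom (inj₁ p) ts
  embed (t ≐ s)     = t ≐ s
  embed ⊥ᶠ          = ⊥ᶠ
  embed (F ∧ᶠ G)    = embed F ∧ᶠ embed G
  embed (F ∨ᶠ G)    = embed F ∨ᶠ embed G
  embed (F ⇒ᶠ G)    = embed F ⇒ᶠ embed G
  embed (∀ᶠ x F)    = ∀ᶠ x (embed F)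
  embed (∃ᶠ x F)    = ∃ᶠ x (embed F)

  -- F*(u), where u ranges over all predicate constants occurring in F
  -- (hence every predicate atom is starred)
  star : Fm → Formula (Pr ⊎ Pr) paU
  star (atom p ts) = atom (inj₂ p) ts
  star (t ≐ s)     = t ≐ s
  star ⊥ᶠ          = ⊥ᶠ
  star (F ∧ᶠ G)    = star F ∧ᶠ star G
  star (F ∨ᶠ G)    = star F ∨ᶠ star G
  star (F ⇒ᶠ G)    = (star F ⇒ᶠ star G) ∧ᶠ (embed F ⇒ᶠ embed G)
  star (∀ᶠ x F)    = ∀ᶠ x (star F)
  star (∃ᶠ x F)    = ∃ᶠ x (star F)

  module _ (M : Structure) where
    open Structure M

    Rels : Set₁
    Rels = (p : Pr) → Vec D (pa p) → Set

    _≤[_]_ : Rels → List Pr → Rels → Set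
    U ≤[ ps ] V = All (λ p → (xs : Vec D (pa p)) → U p xs → V p xs) ps

    withU : Rels → (q : Pr ⊎ Pr) → Vec D (paU q) → Set
    withU U (inj₁ p) = relI p
    withU U (inj₂ p) = U p

  SatSM : Structure → Fm → Set₁
  SatSM M F =
    Sat M F ×
    ¬ (Σ (Rels M) λ U →
         (_≤[_]_ M U ps (Structure.relI M)) ×
         ¬ (_≤[_]_ M (Structure.relI M) ps U) ×
         ((ρ : ℕ → Structure.D M) → evalF M (withU M U) ρ (star F)))
    where ps = deduplicate _≟P_ (preds F)

  record Rule : Set where
    constructor rule
    field
      hd   : Pr
      args : Vec Term (pa hd)
      body : Fm
  open Rule public

  Program : Set
  Program = List Rule

  ruleFormula : Rule → Fm
  ruleFormula r = closure (body r ⇒ᶠ atom (hd r) (args r))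

  progFormula : Program → Fm
  progFormula Π = conj (L.map ruleFormula Π)

  fvRule : Rule → List ℕ
  fvRule r = dedupℕ (tsvars (args r) ++ fv (body r))

  varsRule : Rule → List ℕ
  varsRule r = tsvars (args r) ++ allvars (body r)

  predsΠ : Program → List Pr
  predsΠ Π = deduplicate _≟P_ (preds (progFormula Π))

  eqsL : ∀ {n} → Vec Term n → Vec Term n → List Fm
  eqsL ss ts = toList (V.zipWith _≐_ ss ts)

  rulesFor : (p : Pr) → Program → List (Vec Term (pa p) × Fm × List ℕ)
  rulesFor p [] = []
  rulesFor p (r ∷ Π) with hd r ≟P p
  ... | yes e = (subst (λ q → Vec Term (pa q)) e (args r) , body r , fvRule r) ∷ rulesFor p Π
  ... | no  _ = rulesFor p Π

  freshBase : Program → ℕ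
  freshBase Π = suc (foldr _⊔_ 0 (concatMap varsRule Π))

  freshVars : Program → (p : Pr) → Vec ℕ (pa p)
  freshVars Π p = V.tabulate (λ i → freshBase Π + toℕ i)

  compDef : Program → Pr → Fm
  compDef Π p =
    foralls (toList xs)
      (atom p (V.map var xs) ⇔ᶠ
        disj (L.map (λ { (t , G , ys) → exists ys (conj (eqsL (V.map var xs) t ++ (G ∷ []))) })
                    (rulesFor p Π)))
    where xs = freshVars Π p

  Comp : Program → Fm
  Comp Π = conj (L.map (compDef Π) (predsΠ Π))

  Occ : Set
  Occ = Σ Pr (λ p → Vec Term (pa p))

  -- atoms p(s) with a nonnegated occurrence in F of polarity b
  -- (b = true: positive).  Everything inside a subformula G → ⊥ is negated.
  posNN : Bool → Fm → List Occ
  posNN true  (atom p ts) = (p , ts) ∷ []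
  posNN false (atom p ts) = []
  posNN b (t ≐ s)         = []
  posNN b ⊥ᶠ              = []
  posNN b (F ∧ᶠ G)        = posNN b F ++ posNN b G
  posNN b (F ∨ᶠ G)        = posNN b F ++ posNN b G
  posNN b (F ⇒ᶠ ⊥ᶠ)       = []
  posNN b (F ⇒ᶠ G)        = posNN (not b) F ++ posNN b G
  posNN b (∀ᶠ x F)        = posNN b F
  posNN b (∃ᶠ x F)        = posNN b F

  -- F' is obtained from F by renaming: free variables via ρ, bound
  -- variables arbitrarily (without capture)
  data Ren : (ℕ → ℕ) → Fm → Fm → Set where
    ren-atom : ∀ {ρ p ts} → Ren ρ (atom p ts) (atom p (renTs ρ ts))
    ren-eq   : ∀ {ρ t s} → Ren ρ (t ≐ s) (renT ρ t ≐ renT ρ s)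
    ren-⊥    : ∀ {ρ} → Ren ρ ⊥ᶠ ⊥ᶠ
    ren-∧    : ∀ {ρ F G F' G'} → Ren ρ F F' → Ren ρ G G' → Ren ρ (F ∧ᶠ G) (F' ∧ᶠ G')
    ren-∨    : ∀ {ρ F G F' G'} → Ren ρ F F' → Ren ρ G G' → Ren ρ (F ∨ᶠ G) (F' ∨ᶠ G')
    ren-⇒    : ∀ {ρ F G F' G'} → Ren ρ F F' → Ren ρ G G' → Ren ρ (F ⇒ᶠ G) (F' ⇒ᶠ G')
    ren-∀    : ∀ {ρ x y F F'} → (∀ z → z ∈ fv (∀ᶠ x F) → ρ z ≢ y)
             → Ren (ρ [ x ↦ y ]) F F' → Ren ρ (∀ᶠ x F) (∀ᶠ y F')
    ren-∃    : ∀ {ρ x y F F'} → (∀ z → z ∈ fv (∃ᶠ x F) → ρ z ≢ y)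
             → Ren (ρ [ x ↦ y ]) F F' → Ren ρ (∃ᶠ x F) (∃ᶠ y F')

  Variant : Rule → Rule → Set
  Variant r r' =
    Σ (ℕ → ℕ) λ ρ → Σ Fm λ B →
      ((a b : ℕ) → a ∈ fvRule r → b ∈ fvRule r → ρ a ≡ ρ b → a ≡ b) ×
      Ren ρ (body r) B ×
      r' ≡ rule (hd r) (renTs ρ (args r)) B

  Vertex : Program → Rule → Set
  Vertex Π r' = Σ Rule λ r → r ∈ Π × Variant r r'

  -- a chain of length n: rules rl 0 … rl n, edge i from rl i to rl (i+1)
  -- labelled by  hd (rl (i+1)) (lab i)
  record Chain (Π : Program) (n : ℕ) : Set where
    field
      rl    : Fin (suc n) → Rule
      isV   : (i : Fin (suc n)) → Vertex Π (rl i)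
      lab   : (i : Fin n) → Vec Term (pa (hd (rl (suc i))))
      edge  : (i : Fin n) → (hd (rl (suc i)) , lab i) ∈ posNN true (body (rl (inject₁ i)))
      apart : (i j : Fin (suc n)) → i ≢ j → (v : ℕ) →
              v ∈ varsRule (rl i) → v ∈ varsRule (rl j) → Empty

  chainFormula : {Π : Program} {n : ℕ} → Chain Π n → Fm
  chainFormula {n = n} C =
    conj (concat (L.tabulate (λ (i : Fin n) → eqsL (lab i) (args (rl (suc i)))))
          ++ L.tabulate (λ (i : Fin (suc n)) → body (rl i)))
    where open Chain C

  EntailsComp : (Fm → Set) → Program → Fm → Set₁
  EntailsComp Γ Π F =
    (M : Structure) → ((G : Fm) → Γ G → Sat M G) → Sat M (Comp Π) → Sat M F

  Tight : (Fm → Set) → Program → Set₁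
  Tight Γ Π =
    Σ ℕ λ n → (1 Data.Nat.≤ n) ×
      ((C : Chain Π n) → EntailsComp Γ Π (closure (¬ᶠ (chainFormula C))))

module Submission where

-- SM[Π] → Comp[Π]: the "if" halves of the completed definitions hold in every model of Π. For the
-- "only if" halves, an atom p(d) of I supported by no rule instance could be removed from I: the
-- result U < I still satisfies Π*, against the minimality of I.
--
-- Comp[Π] → SM[Π]: Comp[Π] implies Π. Suppose U < I satisfies Π*, and pick p(d) in I but not in U.
-- The completion yields a rule instance with head p(d) whose body B holds in I; as p(d) ∉ U, B* fails
-- in U, and then some positive nonnegated atom of B is again in I but not in U. Iterating gives an
-- infinite walk in the rule dependency graph. Renaming the k-th rule into its own block of variables
-- turns every finite prefix into a chain whose chain formula is satisfied, contradicting Γ-tightness.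

open import Defs
open import Level using (Lift; lift; lower) renaming (zero to lzero; suc to lsuc)
open import Axiom.ExcludedMiddle using (ExcludedMiddle)
open import Axiom.DoubleNegationElimination using (em⇒dne)
open import Function.Base using (id; _∘_)
open import Function.Bundles using (_⇔_; mk⇔; Equivalence)

open import Data.Nat using (ℕ; zero; suc; _+_; _*_; _∸_; _⊔_; _<_; _≤_; s≤s; ⌊_/2⌋; NonZero)
open import Data.Nat.Properties
  using (suc-injective; +-cancelˡ-≡; *-cancelˡ-≡; even≢odd; n≡⌊n+n/2⌋; +-identityʳ; m+n∸m≡n;
         m≤m+n; m≤m⊔n; m≤n⊔m; ≤-trans; <-≤-trans; <-trans; n≮n; n<1+n; *-suc; *-monoʳ-≤)
  renaming (_≟_ to _≟ℕ_)
open import Data.Nat.DivMod using (_/_; +-distrib-/-∣ˡ; m*n/n≡m; m<n⇒m/n≡0)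
open import Data.Nat.Divisibility using (n∣m*n)
open import Data.Bool using (Bool; true; false; not)
open import Data.Fin using (Fin; zero; suc; inject₁; toℕ)
open import Data.Fin.Properties using (toℕ-injective; toℕ-inject₁)
open import Data.Vec using (Vec; []; _∷_; toList)
import Data.Vec as V
open import Data.Vec.Properties using (∷-injectiveˡ; ∷-injectiveʳ; tabulate-∘; tabulate-cong; tabulate∘lookup)
open import Data.List using (List; []; _∷_; _++_; foldr; concatMap)
import Data.List as L
open import Data.List.Membership.Propositional using (_∈_; _∉_; find; lose)
open import Data.List.Membership.DecPropositional _≟ℕ_ using (_∈?_)
open import Data.List.Membership.Propositional.Properties
  using (∈-filter⁺; ∈-filter⁻; ∈-++⁺ˡ; ∈-++⁺ʳ; ∈-++⁻; ∈-map⁺; ∈-map⁻; ∈-deduplicate⁺; ∈-deduplicate⁻; ∈-concatMap⁺)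
open import Data.List.Relation.Binary.Subset.Propositional using (_⊆_)
open import Data.List.Relation.Unary.Any using (Any; here; there)
import Data.List.Relation.Unary.Any as Any
import Data.List.Relation.Unary.Any.Properties as Any
open import Data.List.Relation.Unary.All using (All; []; _∷_)
import Data.List.Relation.Unary.All as All
import Data.List.Relation.Unary.All.Properties as All
open import Data.Product using (Σ; Σ-syntax; _×_; _,_; proj₁; proj₂)
import Data.Product
open import Data.Product.Properties using (Σ-≡,≡←≡)
open import Data.Sum using (_⊎_; inj₁; inj₂)
import Data.Sum
open import Data.Empty using (⊥-elim) renaming (⊥ to Empty)
open import Relation.Nullary using (¬_; yes; no; ¬?)
open import Relation.Nullary.Decidable using (map′)
open import Relation.Binary.PropositionalEquality
  using (_≡_; _≢_; refl; sym; trans; cong; cong₂; subst; module ≡-Reasoning)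

excludedMiddle₀ : ExcludedMiddle (lsuc lzero) → ExcludedMiddle lzero
excludedMiddle₀ em {P} = map′ lower lift (em {Lift (lsuc lzero) P})

module _ (em : ExcludedMiddle lzero) where

  ¬∀⇒∃¬ : {A : Set} {P : A → Set} → ¬ (∀ a → P a) → Σ A (¬_ ∘ P)
  ¬∀⇒∃¬ {A} {P} ¬∀ with em {Σ A (¬_ ∘ P)}
  ... | yes ∃¬ = ∃¬
  ... | no ¬∃¬ = ⊥-elim (¬∀ λ a → em⇒dne em λ ¬Pa → ¬∃¬ (a , ¬Pa))

  ¬→⇒×¬ : {A B : Set} → ¬ (A → B) → A × ¬ B
  ¬→⇒×¬ {A} ¬A→B with em {A}
  ... | yes a  = a , λ b → ¬A→B λ _ → b
  ... | no ¬a = ⊥-elim (¬A→B (⊥-elim ∘ ¬a))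

[k*n+u]/n≡k : ∀ k n u .{{_ : NonZero n}} → u < n → (k * n + u) / n ≡ k
[k*n+u]/n≡k k n u u<n = begin
  (k * n + u) / n    ≡⟨ +-distrib-/-∣ˡ u (n∣m*n k) ⟩
  k * n / n + u / n  ≡⟨ cong₂ _+_ (m*n/n≡m k n) (m<n⇒m/n≡0 u<n) ⟩
  k + 0              ≡⟨ +-identityʳ k ⟩
  k                  ∎
  where open ≡-Reasoning

1+2*m<2*n : ∀ {m n} → m < n → suc (2 * m) < 2 * n
1+2*m<2*n {m} {n} m<n = ≤-trans (n<1+n (suc (2 * m))) (subst (_≤ 2 * n) (*-suc 2 m) (*-monoʳ-≤ 2 m<n))

module _ {A : Set} (f : ℕ → A) (x : ℕ) where

  [↦]-same : (a : A) → (f [ x ↦ a ]) x ≡ a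
  [↦]-same a with x ≟ℕ x
  ... | yes _  = refl
  ... | no x≢x = ⊥-elim (x≢x refl)

  [↦]-other : (a : A) {y : ℕ} → y ≢ x → (f [ x ↦ a ]) y ≡ f y
  [↦]-other a {y} y≢x with y ≟ℕ x
  ... | yes y≡x = ⊥-elim (y≢x y≡x)
  ... | no _    = refl

  [↦]-self : (y : ℕ) → (f [ x ↦ f x ]) y ≡ f y
  [↦]-self y with y ≟ℕ x
  ... | yes refl = refl
  ... | no _     = refl

  [↦]-cong : (g : ℕ → A) (a : A) (vs : List ℕ) → (∀ v → v ∈ removeℕ x vs → f v ≡ g v)
           → ∀ v → v ∈ vs → (f [ x ↦ a ]) v ≡ (g [ x ↦ a ]) v
  [↦]-cong g a vs f≗g v v∈vs with v ≟ℕ x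
  ... | yes _  = refl
  ... | no v≢x = f≗g v (∈-filter⁺ (λ y → ¬? (y ≟ℕ x)) v∈vs v≢x)

lookupOr : {A : Set} {n : ℕ} → A → Vec A n → ℕ → A
lookupOr a []       k       = a
lookupOr a (x ∷ xs) zero    = x
lookupOr a (x ∷ xs) (suc k) = lookupOr a xs k

lookupOr-toℕ : {A : Set} {n : ℕ} (a : A) (xs : Vec A n) (i : Fin n) → lookupOr a xs (toℕ i) ≡ V.lookup xs i
lookupOr-toℕ a (x ∷ xs) zero    = refl
lookupOr-toℕ a (x ∷ xs) (suc i) = lookupOr-toℕ a xs i

override : {A : Set} → List ℕ → (ℕ → A) → (ℕ → A) → ℕ → A
override ys ρ₁ ρ₂ v with v ∈? ys
... | yes _ = ρ₁ v
... | no _  = ρ₂ v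

override-∈ : {A : Set} (ys : List ℕ) (ρ₁ ρ₂ : ℕ → A) {v : ℕ} → v ∈ ys → override ys ρ₁ ρ₂ v ≡ ρ₁ v
override-∈ ys ρ₁ ρ₂ {v} v∈ with v ∈? ys
... | yes _  = refl
... | no v∉ = ⊥-elim (v∉ v∈)

override-∉ : {A : Set} (ys : List ℕ) (ρ₁ ρ₂ : ℕ → A) {v : ℕ} → v ∉ ys → override ys ρ₁ ρ₂ v ≡ ρ₂ v
override-∉ ys ρ₁ ρ₂ {v} v∉ with v ∈? ys
... | yes v∈ = ⊥-elim (v∉ v∈)
... | no _   = refl

module _ (S : Signature) where
  open Signature S

  star-foralls : (xs : List ℕ) (F : Fm S) → star S (foralls S xs F) ≡ foldr ∀ᶠ (star S F) xs
  star-foralls []       F = refl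
  star-foralls (x ∷ xs) F = cong (∀ᶠ x) (star-foralls xs F)

  boundVars : {Q : Set} {qa : Q → ℕ} → Formula S Q qa → List ℕ
  boundVars (atom q ts) = []
  boundVars (t ≐ s)     = []
  boundVars ⊥ᶠ          = []
  boundVars (F ∧ᶠ G)    = boundVars F ++ boundVars G
  boundVars (F ∨ᶠ G)    = boundVars F ++ boundVars G
  boundVars (F ⇒ᶠ G)    = boundVars F ++ boundVars G
  boundVars (∀ᶠ x F)    = x ∷ boundVars F
  boundVars (∃ᶠ x F)    = x ∷ boundVars F

  posNN-⇒ : (b : Bool) (F G : Fm S) → G ≡ ⊥ᶠ ⊎ posNN S b (F ⇒ᶠ G) ≡ posNN S (not b) F ++ posNN S b G
  posNN-⇒ _     F ⊥ᶠ         = inj₁ refl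
  posNN-⇒ true  F (atom _ _) = inj₂ refl
  posNN-⇒ true  F (_ ≐ _)    = inj₂ refl
  posNN-⇒ true  F (_ ∧ᶠ _)   = inj₂ refl
  posNN-⇒ true  F (_ ∨ᶠ _)   = inj₂ refl
  posNN-⇒ true  F (_ ⇒ᶠ _)   = inj₂ refl
  posNN-⇒ true  F (∀ᶠ _ _)   = inj₂ refl
  posNN-⇒ true  F (∃ᶠ _ _)   = inj₂ refl
  posNN-⇒ false F (atom _ _) = inj₂ refl
  posNN-⇒ false F (_ ≐ _)    = inj₂ refl
  posNN-⇒ false F (_ ∧ᶠ _)   = inj₂ refl
  posNN-⇒ false F (_ ∨ᶠ _)   = inj₂ refl
  posNN-⇒ false F (_ ⇒ᶠ _)   = inj₂ refl
  posNN-⇒ false F (∀ᶠ _ _)   = inj₂ refl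
  posNN-⇒ false F (∃ᶠ _ _)   = inj₂ refl

  OccursIn : List Pr → List ℕ → Occ S → Set
  OccursIn ps vs (q , s) = q ∈ ps × tsvars S s ⊆ vs

  mutual
    posNN-occursIn : (b : Bool) (F : Fm S) {o : Occ S} → o ∈ posNN S b F → OccursIn (preds S F) (allvars S F) o
    posNN-occursIn true  (atom p ts) (here refl) = here refl , id
    posNN-occursIn true  (F ∧ᶠ G)    o∈ = posNN-++-occursIn true true F G o∈
    posNN-occursIn false (F ∧ᶠ G)    o∈ = posNN-++-occursIn false false F G o∈
    posNN-occursIn true  (F ∨ᶠ G)    o∈ = posNN-++-occursIn true true F G o∈
    posNN-occursIn false (F ∨ᶠ G)    o∈ = posNN-++-occursIn false false F G o∈
    posNN-occursIn b     (F ⇒ᶠ G)    o∈ with posNN-⇒ b F G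
    posNN-occursIn true  (F ⇒ᶠ G)    () | inj₁ refl
    posNN-occursIn false (F ⇒ᶠ G)    () | inj₁ refl
    ... | inj₂ eq = posNN-++-occursIn (not b) b F G (subst (_ ∈_) eq o∈)
    posNN-occursIn true  (∀ᶠ x F)    o∈ = let q∈ , s⊆ = posNN-occursIn true F o∈ in q∈ , there ∘ s⊆
    posNN-occursIn false (∀ᶠ x F)    o∈ = let q∈ , s⊆ = posNN-occursIn false F o∈ in q∈ , there ∘ s⊆
    posNN-occursIn true  (∃ᶠ x F)    o∈ = let q∈ , s⊆ = posNN-occursIn true F o∈ in q∈ , there ∘ s⊆
    posNN-occursIn false (∃ᶠ x F)    o∈ = let q∈ , s⊆ = posNN-occursIn false F o∈ in q∈ , there ∘ s⊆

    posNN-++-occursIn : (b₁ b₂ : Bool) (F G : Fm S) {o : Occ S} → o ∈ posNN S b₁ F ++ posNN S b₂ G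
                      → OccursIn (preds S F ++ preds S G) (allvars S F ++ allvars S G) o
    posNN-++-occursIn b₁ b₂ F G o∈ with ∈-++⁻ (posNN S b₁ F) o∈
    ... | inj₁ o∈F = let q∈ , s⊆ = posNN-occursIn b₁ F o∈F in ∈-++⁺ˡ q∈ , ∈-++⁺ˡ ∘ s⊆
    ... | inj₂ o∈G = let q∈ , s⊆ = posNN-occursIn b₂ G o∈G in ∈-++⁺ʳ (preds S F) q∈ , ∈-++⁺ʳ (allvars S F) ∘ s⊆

  mutual
    fv⊆allvars : {Q : Set} {qa : Q → ℕ} (F : Formula S Q qa) → fv S F ⊆ allvars S F
    fv⊆allvars (atom q ts) v∈ = v∈
    fv⊆allvars (t ≐ s)     v∈ = v∈
    fv⊆allvars (F ∧ᶠ G)    v∈ = fv⊆allvars-++ F G v∈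
    fv⊆allvars (F ∨ᶠ G)    v∈ = fv⊆allvars-++ F G v∈
    fv⊆allvars (F ⇒ᶠ G)    v∈ = fv⊆allvars-++ F G v∈
    fv⊆allvars (∀ᶠ x F)    v∈ = there (fv⊆allvars F (proj₁ (∈-filter⁻ _ {xs = fv S F} v∈)))
    fv⊆allvars (∃ᶠ x F)    v∈ = there (fv⊆allvars F (proj₁ (∈-filter⁻ _ {xs = fv S F} v∈)))

    fv⊆allvars-++ : {Q : Set} {qa : Q → ℕ} (F G : Formula S Q qa) → fv S F ++ fv S G ⊆ allvars S F ++ allvars S G
    fv⊆allvars-++ F G v∈ with ∈-++⁻ (fv S F) v∈
    ... | inj₁ v∈F = ∈-++⁺ˡ (fv⊆allvars F v∈F)
    ... | inj₂ v∈G = ∈-++⁺ʳ (allvars S F) (fv⊆allvars G v∈G)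

  module Semantics (M : Structure S) where
    open Structure M

    Interp : (Q : Set) → (Q → ℕ) → Set₁
    Interp Q qa = (q : Q) → Vec D (qa q) → Set

    mutual
      evalT-cong : (t : Term S) (ρ ρ' : ℕ → D) → (∀ v → v ∈ tvars S t → ρ v ≡ ρ' v)
                 → evalT S M ρ t ≡ evalT S M ρ' t
      evalT-cong (var x)    ρ ρ' ρ≗ρ' = ρ≗ρ' x (here refl)
      evalT-cong (app f ts) ρ ρ' ρ≗ρ' = cong (funI f) (evalTs-cong ts ρ ρ' ρ≗ρ')

      evalTs-cong : ∀ {n} (ts : Vec (Term S) n) (ρ ρ' : ℕ → D) → (∀ v → v ∈ tsvars S ts → ρ v ≡ ρ' v)
                  → evalTs S M ρ ts ≡ evalTs S M ρ' ts
      evalTs-cong []       ρ ρ' ρ≗ρ' = refl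
      evalTs-cong (t ∷ ts) ρ ρ' ρ≗ρ' =
        cong₂ _∷_ (evalT-cong t ρ ρ' (λ v → ρ≗ρ' v ∘ ∈-++⁺ˡ))
                  (evalTs-cong ts ρ ρ' (λ v → ρ≗ρ' v ∘ ∈-++⁺ʳ (tvars S t)))

    evalTs-map-var : ∀ {n} (ρ : ℕ → D) (xs : Vec ℕ n) → evalTs S M ρ (V.map var xs) ≡ V.map ρ xs
    evalTs-map-var ρ []       = refl
    evalTs-map-var ρ (x ∷ xs) = cong (ρ x ∷_) (evalTs-map-var ρ xs)

    evalF-cong : {Q : Set} {qa : Q → ℕ} (R : Interp Q qa) (F : Formula S Q qa) (ρ ρ' : ℕ → D)
               → (∀ v → v ∈ fv S F → ρ v ≡ ρ' v) → evalF S M R ρ F → evalF S M R ρ' F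
    evalF-cong R (atom q ts) ρ ρ' ρ≗ρ' = subst (R q) (evalTs-cong ts ρ ρ' ρ≗ρ')
    evalF-cong R (t ≐ s)     ρ ρ' ρ≗ρ' t≡s =
      trans (sym (evalT-cong t ρ ρ' (λ v → ρ≗ρ' v ∘ ∈-++⁺ˡ)))
            (trans t≡s (evalT-cong s ρ ρ' (λ v → ρ≗ρ' v ∘ ∈-++⁺ʳ (tvars S t))))
    evalF-cong R ⊥ᶠ          ρ ρ' ρ≗ρ' ()
    evalF-cong R (F ∧ᶠ G)    ρ ρ' ρ≗ρ' (a , b) =
      evalF-cong R F ρ ρ' (λ v → ρ≗ρ' v ∘ ∈-++⁺ˡ) a , evalF-cong R G ρ ρ' (λ v → ρ≗ρ' v ∘ ∈-++⁺ʳ (fv S F)) b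
    evalF-cong R (F ∨ᶠ G)    ρ ρ' ρ≗ρ' (inj₁ a) = inj₁ (evalF-cong R F ρ ρ' (λ v → ρ≗ρ' v ∘ ∈-++⁺ˡ) a)
    evalF-cong R (F ∨ᶠ G)    ρ ρ' ρ≗ρ' (inj₂ b) = inj₂ (evalF-cong R G ρ ρ' (λ v → ρ≗ρ' v ∘ ∈-++⁺ʳ (fv S F)) b)
    evalF-cong R (F ⇒ᶠ G)    ρ ρ' ρ≗ρ' f a =
      evalF-cong R G ρ ρ' (λ v → ρ≗ρ' v ∘ ∈-++⁺ʳ (fv S F))
        (f (evalF-cong R F ρ' ρ (λ v → sym ∘ ρ≗ρ' v ∘ ∈-++⁺ˡ) a))
    evalF-cong R (∀ᶠ x F)    ρ ρ' ρ≗ρ' f d =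
      evalF-cong R F (ρ [ x ↦ d ]) (ρ' [ x ↦ d ]) ([↦]-cong ρ x ρ' d (fv S F) ρ≗ρ') (f d)
    evalF-cong R (∃ᶠ x F)    ρ ρ' ρ≗ρ' (d , a) =
      d , evalF-cong R F (ρ [ x ↦ d ]) (ρ' [ x ↦ d ]) ([↦]-cong ρ x ρ' d (fv S F) ρ≗ρ') a

    evalF-ext : {Q : Set} {qa : Q → ℕ} (R : Interp Q qa) (F : Formula S Q qa) (ρ ρ' : ℕ → D)
              → (∀ v → ρ v ≡ ρ' v) → evalF S M R ρ F → evalF S M R ρ' F
    evalF-ext R F ρ ρ' ρ≗ρ' = evalF-cong R F ρ ρ' (λ v _ → ρ≗ρ' v)

    module _ {Q : Set} {qa : Q → ℕ} (R : Interp Q qa) where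

      evalF-foralls⁻ : (xs : List ℕ) (F : Formula S Q qa) (ρ : ℕ → D)
                     → evalF S M R ρ (foldr ∀ᶠ F xs) → evalF S M R ρ F
      evalF-foralls⁻ []       F ρ h = h
      evalF-foralls⁻ (x ∷ xs) F ρ h =
        evalF-foralls⁻ xs F ρ (evalF-ext R (foldr ∀ᶠ F xs) (ρ [ x ↦ ρ x ]) ρ ([↦]-self ρ x) (h (ρ x)))

      evalF-foralls⁺ : (xs : List ℕ) (F : Formula S Q qa)
                     → (∀ ρ → evalF S M R ρ F) → ∀ ρ → evalF S M R ρ (foldr ∀ᶠ F xs)
      evalF-foralls⁺ []       F h ρ   = h ρ
      evalF-foralls⁺ (x ∷ xs) F h ρ d = evalF-foralls⁺ xs F h (ρ [ x ↦ d ])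

      evalF-exists⁻ : (ys : List ℕ) (F : Formula S Q qa) (ρ : ℕ → D) → evalF S M R ρ (foldr ∃ᶠ F ys)
                    → Σ[ σ ∈ (ℕ → D) ] (∀ v → v ∉ ys → σ v ≡ ρ v) × evalF S M R σ F
      evalF-exists⁻ []       F ρ h       = ρ , (λ _ _ → refl) , h
      evalF-exists⁻ (y ∷ ys) F ρ (d , h) with evalF-exists⁻ ys F (ρ [ y ↦ d ]) h
      ... | σ , σ≈ρ , hσ = σ , (λ v v∉ → trans (σ≈ρ v (v∉ ∘ there)) ([↦]-other ρ y d (v∉ ∘ here))) , hσ

      evalF-exists⁺ : (ys : List ℕ) (F : Formula S Q qa) (σ ρ : ℕ → D) → (∀ v → v ∉ ys → σ v ≡ ρ v)
                    → evalF S M R σ F → evalF S M R ρ (foldr ∃ᶠ F ys)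
      evalF-exists⁺ []       F σ ρ σ≈ρ h = evalF-ext R F σ ρ (λ v → σ≈ρ v λ ()) h
      evalF-exists⁺ (y ∷ ys) F σ ρ σ≈ρ h = σ y , evalF-exists⁺ ys F σ (ρ [ y ↦ σ y ]) σ≈ρ[y] h
        where
        σ≈ρ[y] : ∀ v → v ∉ ys → σ v ≡ (ρ [ y ↦ σ y ]) v
        σ≈ρ[y] v v∉ with v ≟ℕ y
        ... | yes refl = refl
        ... | no v≢y   = σ≈ρ v λ { (here v≡y) → v≢y v≡y ; (there v∈) → v∉ v∈ }

    module _ (R : Rels S M) where

      evalF-conj⁻ : (Fs : List (Fm S)) (ρ : ℕ → D) → evalF S M R ρ (conj S Fs) → All (evalF S M R ρ) Fs
      evalF-conj⁻ []           ρ _       = []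
      evalF-conj⁻ (F ∷ [])     ρ a       = a ∷ []
      evalF-conj⁻ (F ∷ G ∷ Fs) ρ (a , b) = a ∷ evalF-conj⁻ (G ∷ Fs) ρ b

      evalF-conj⁺ : (Fs : List (Fm S)) (ρ : ℕ → D) → All (evalF S M R ρ) Fs → evalF S M R ρ (conj S Fs)
      evalF-conj⁺ []           ρ _        = id
      evalF-conj⁺ (F ∷ [])     ρ (a ∷ []) = a
      evalF-conj⁺ (F ∷ G ∷ Fs) ρ (a ∷ b)  = a , evalF-conj⁺ (G ∷ Fs) ρ b

      evalF-disj⁻ : (Fs : List (Fm S)) (ρ : ℕ → D) → evalF S M R ρ (disj S Fs) → Any (evalF S M R ρ) Fs
      evalF-disj⁻ (F ∷ [])     ρ a        = here a
      evalF-disj⁻ (F ∷ G ∷ Fs) ρ (inj₁ a) = here a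
      evalF-disj⁻ (F ∷ G ∷ Fs) ρ (inj₂ b) = there (evalF-disj⁻ (G ∷ Fs) ρ b)

      evalF-disj⁺ : (Fs : List (Fm S)) (ρ : ℕ → D) → Any (evalF S M R ρ) Fs → evalF S M R ρ (disj S Fs)
      evalF-disj⁺ (F ∷ [])     ρ (here a)  = a
      evalF-disj⁺ (F ∷ G ∷ Fs) ρ (here a)  = inj₁ a
      evalF-disj⁺ (F ∷ G ∷ Fs) ρ (there b) = inj₂ (evalF-disj⁺ (G ∷ Fs) ρ b)

      evalF-eqsL⁻ : ∀ {n} (ss ts : Vec (Term S) n) (ρ : ℕ → D)
                  → All (evalF S M R ρ) (eqsL S ss ts) → evalTs S M ρ ss ≡ evalTs S M ρ ts
      evalF-eqsL⁻ []       []       ρ []        = refl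
      evalF-eqsL⁻ (s ∷ ss) (t ∷ ts) ρ (s≡t ∷ h) = cong₂ _∷_ s≡t (evalF-eqsL⁻ ss ts ρ h)

      evalF-eqsL⁺ : ∀ {n} (ss ts : Vec (Term S) n) (ρ : ℕ → D)
                  → evalTs S M ρ ss ≡ evalTs S M ρ ts → All (evalF S M R ρ) (eqsL S ss ts)
      evalF-eqsL⁺ []       []       ρ _  = []
      evalF-eqsL⁺ (s ∷ ss) (t ∷ ts) ρ eq = ∷-injectiveˡ eq ∷ evalF-eqsL⁺ ss ts ρ (∷-injectiveʳ eq)

    Sat-conj⁻ : (Fs : List (Fm S)) → Sat S M (conj S Fs) → ∀ {F} → F ∈ Fs → Sat S M F
    Sat-conj⁻ Fs h F∈Fs ρ = All.lookup (evalF-conj⁻ relI Fs ρ (h ρ)) F∈Fs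

    Sat-conj⁺ : (Fs : List (Fm S)) → (∀ {F} → F ∈ Fs → Sat S M F) → Sat S M (conj S Fs)
    Sat-conj⁺ Fs h ρ = evalF-conj⁺ relI Fs ρ (All.tabulate λ F∈Fs → h F∈Fs ρ)

    module _ (R : Interp (Pr ⊎ Pr) (paU S)) where

      evalF-star-conj⁻ : (Fs : List (Fm S)) (ρ : ℕ → D)
                       → evalF S M R ρ (star S (conj S Fs)) → All (evalF S M R ρ ∘ star S) Fs
      evalF-star-conj⁻ []           ρ _       = []
      evalF-star-conj⁻ (F ∷ [])     ρ a       = a ∷ []
      evalF-star-conj⁻ (F ∷ G ∷ Fs) ρ (a , b) = a ∷ evalF-star-conj⁻ (G ∷ Fs) ρ b

      evalF-star-conj⁺ : (Fs : List (Fm S)) (ρ : ℕ → D)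
                       → All (evalF S M R ρ ∘ star S) Fs → evalF S M R ρ (star S (conj S Fs))
      evalF-star-conj⁺ []           ρ _        = id , id
      evalF-star-conj⁺ (F ∷ [])     ρ (a ∷ []) = a
      evalF-star-conj⁺ (F ∷ G ∷ Fs) ρ (a ∷ b)  = a , evalF-star-conj⁺ (G ∷ Fs) ρ b

    module _ (U : Rels S M) where

      mutual
        evalF-embed⁻ : (F : Fm S) (ρ : ℕ → D) → evalF S M (withU S M U) ρ (embed S F) → evalF S M relI ρ F
        evalF-embed⁻ (atom p ts) ρ a        = a
        evalF-embed⁻ (t ≐ s)     ρ a        = a
        evalF-embed⁻ ⊥ᶠ          ρ ()
        evalF-embed⁻ (F ∧ᶠ G)    ρ (a , b)  = evalF-embed⁻ F ρ a , evalF-embed⁻ G ρ b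
        evalF-embed⁻ (F ∨ᶠ G)    ρ (inj₁ a) = inj₁ (evalF-embed⁻ F ρ a)
        evalF-embed⁻ (F ∨ᶠ G)    ρ (inj₂ b) = inj₂ (evalF-embed⁻ G ρ b)
        evalF-embed⁻ (F ⇒ᶠ G)    ρ f        = evalF-embed⁻ G ρ ∘ f ∘ evalF-embed⁺ F ρ
        evalF-embed⁻ (∀ᶠ x F)    ρ f d      = evalF-embed⁻ F (ρ [ x ↦ d ]) (f d)
        evalF-embed⁻ (∃ᶠ x F)    ρ (d , a)  = d , evalF-embed⁻ F (ρ [ x ↦ d ]) a

        evalF-embed⁺ : (F : Fm S) (ρ : ℕ → D) → evalF S M relI ρ F → evalF S M (withU S M U) ρ (embed S F)
        evalF-embed⁺ (atom p ts) ρ a        = a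
        evalF-embed⁺ (t ≐ s)     ρ a        = a
        evalF-embed⁺ ⊥ᶠ          ρ ()
        evalF-embed⁺ (F ∧ᶠ G)    ρ (a , b)  = evalF-embed⁺ F ρ a , evalF-embed⁺ G ρ b
        evalF-embed⁺ (F ∨ᶠ G)    ρ (inj₁ a) = inj₁ (evalF-embed⁺ F ρ a)
        evalF-embed⁺ (F ∨ᶠ G)    ρ (inj₂ b) = inj₂ (evalF-embed⁺ G ρ b)
        evalF-embed⁺ (F ⇒ᶠ G)    ρ f        = evalF-embed⁺ G ρ ∘ f ∘ evalF-embed⁻ F ρ
        evalF-embed⁺ (∀ᶠ x F)    ρ f d      = evalF-embed⁺ F (ρ [ x ↦ d ]) (f d)
        evalF-embed⁺ (∃ᶠ x F)    ρ (d , a)  = d , evalF-embed⁺ F (ρ [ x ↦ d ]) a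

      evalF-star⇒evalF : (F : Fm S) (ρ : ℕ → D) → _≤[_]_ S M U (preds S F) relI
                       → evalF S M (withU S M U) ρ (star S F) → evalF S M relI ρ F
      evalF-star⇒evalF (atom p ts) ρ (U≤I ∷ []) a = U≤I _ a
      evalF-star⇒evalF (t ≐ s)     ρ _   a        = a
      evalF-star⇒evalF ⊥ᶠ          ρ _   ()
      evalF-star⇒evalF (F ∧ᶠ G)    ρ U≤I (a , b)  =
        evalF-star⇒evalF F ρ (All.++⁻ˡ (preds S F) U≤I) a , evalF-star⇒evalF G ρ (All.++⁻ʳ (preds S F) U≤I) b
      evalF-star⇒evalF (F ∨ᶠ G)    ρ U≤I (inj₁ a) = inj₁ (evalF-star⇒evalF F ρ (All.++⁻ˡ (preds S F) U≤I) a)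
      evalF-star⇒evalF (F ∨ᶠ G)    ρ U≤I (inj₂ b) = inj₂ (evalF-star⇒evalF G ρ (All.++⁻ʳ (preds S F) U≤I) b)
      evalF-star⇒evalF (F ⇒ᶠ G)    ρ _   (_ , f)  = evalF-embed⁻ (F ⇒ᶠ G) ρ f
      evalF-star⇒evalF (∀ᶠ x F)    ρ U≤I f d      = evalF-star⇒evalF F (ρ [ x ↦ d ]) U≤I (f d)
      evalF-star⇒evalF (∃ᶠ x F)    ρ U≤I (d , a)  = d , evalF-star⇒evalF F (ρ [ x ↦ d ]) U≤I a

  -- Renaming into a block of variables

  -- The rule at position k of a chain is renamed into the block starting at c = k · blockWidth:
  -- its free variable v becomes c + 2v and its bound variable x becomes c + 2x + 1.
  module Block (c : ℕ) where

    free bound : ℕ → ℕ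
    free  v = c + 2 * v
    bound v = c + suc (2 * v)

    free-injective : ∀ {a b} → free a ≡ free b → a ≡ b
    free-injective {a} {b} = *-cancelˡ-≡ a b 2 ∘ +-cancelˡ-≡ c _ _

    bound-injective : ∀ {a b} → bound a ≡ bound b → a ≡ b
    bound-injective {a} {b} = *-cancelˡ-≡ a b 2 ∘ suc-injective ∘ +-cancelˡ-≡ c _ _

    free≢bound : ∀ a b → free a ≢ bound b
    free≢bound a b = even≢odd a b ∘ +-cancelˡ-≡ c _ _

    decode : ℕ → ℕ
    decode w = ⌊ (w ∸ c) /2⌋

    decode-free : ∀ v → decode (free v) ≡ v
    decode-free v = begin
      ⌊ (c + 2 * v ∸ c) /2⌋ ≡⟨ cong ⌊_/2⌋ (m+n∸m≡n c (2 * v)) ⟩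
      ⌊ v + (v + 0) /2⌋     ≡⟨ cong (λ n → ⌊ v + n /2⌋) (+-identityʳ v) ⟩
      ⌊ v + v /2⌋           ≡⟨ sym (n≡⌊n+n/2⌋ v) ⟩
      v                     ∎
      where open ≡-Reasoning

    FreeOrBound : ℕ → ℕ → Set
    FreeOrBound v w = w ≡ free v ⊎ w ≡ bound v

    Tagged : (ℕ → ℕ) → Set
    Tagged f = ∀ v → FreeOrBound v (f v)

    Tagged-free : Tagged free
    Tagged-free v = inj₁ refl

    Tagged-bind : ∀ {f} x → Tagged f → Tagged (f [ x ↦ bound x ])
    Tagged-bind {f} x tf v with v ≟ℕ x
    ... | yes refl = inj₂ refl
    ... | no _     = tf v

    Tagged-avoids : ∀ {f} → Tagged f → ∀ {v} x → v ≢ x → f v ≢ bound x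
    Tagged-avoids tf {v} x v≢x fv≡ with tf v
    ... | inj₁ fv≡free  = free≢bound v x (trans (sym fv≡free) fv≡)
    ... | inj₂ fv≡bound = v≢x (bound-injective (trans (sym fv≡bound) fv≡))

    rename : {Q : Set} {qa : Q → ℕ} → (ℕ → ℕ) → Formula S Q qa → Formula S Q qa
    rename f (atom q ts) = atom q (renTs S f ts)
    rename f (t ≐ s)     = renT S f t ≐ renT S f s
    rename f ⊥ᶠ          = ⊥ᶠ
    rename f (F ∧ᶠ G)    = rename f F ∧ᶠ rename f G
    rename f (F ∨ᶠ G)    = rename f F ∨ᶠ rename f G
    rename f (F ⇒ᶠ G)    = rename f F ⇒ᶠ rename f G
    rename f (∀ᶠ x F)    = ∀ᶠ (bound x) (rename (f [ x ↦ bound x ]) F)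
    rename f (∃ᶠ x F)    = ∃ᶠ (bound x) (rename (f [ x ↦ bound x ]) F)

    embed-rename : (f : ℕ → ℕ) (F : Fm S) → embed S (rename f F) ≡ rename f (embed S F)
    embed-rename f (atom q ts) = refl
    embed-rename f (t ≐ s)     = refl
    embed-rename f ⊥ᶠ          = refl
    embed-rename f (F ∧ᶠ G)    = cong₂ _∧ᶠ_ (embed-rename f F) (embed-rename f G)
    embed-rename f (F ∨ᶠ G)    = cong₂ _∨ᶠ_ (embed-rename f F) (embed-rename f G)
    embed-rename f (F ⇒ᶠ G)    = cong₂ _⇒ᶠ_ (embed-rename f F) (embed-rename f G)
    embed-rename f (∀ᶠ x F)    = cong (∀ᶠ (bound x)) (embed-rename _ F)
    embed-rename f (∃ᶠ x F)    = cong (∃ᶠ (bound x)) (embed-rename _ F)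

    star-rename : (f : ℕ → ℕ) (F : Fm S) → star S (rename f F) ≡ rename f (star S F)
    star-rename f (atom q ts) = refl
    star-rename f (t ≐ s)     = refl
    star-rename f ⊥ᶠ          = refl
    star-rename f (F ∧ᶠ G)    = cong₂ _∧ᶠ_ (star-rename f F) (star-rename f G)
    star-rename f (F ∨ᶠ G)    = cong₂ _∨ᶠ_ (star-rename f F) (star-rename f G)
    star-rename f (F ⇒ᶠ G)    =
      cong₂ _∧ᶠ_ (cong₂ _⇒ᶠ_ (star-rename f F) (star-rename f G)) (cong₂ _⇒ᶠ_ (embed-rename f F) (embed-rename f G))
    star-rename f (∀ᶠ x F)    = cong (∀ᶠ (bound x)) (star-rename _ F)
    star-rename f (∃ᶠ x F)    = cong (∃ᶠ (bound x)) (star-rename _ F)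

    preds-rename : (f : ℕ → ℕ) (F : Fm S) → preds S (rename f F) ≡ preds S F
    preds-rename f (atom q ts) = refl
    preds-rename f (t ≐ s)     = refl
    preds-rename f ⊥ᶠ          = refl
    preds-rename f (F ∧ᶠ G)    = cong₂ _++_ (preds-rename f F) (preds-rename f G)
    preds-rename f (F ∨ᶠ G)    = cong₂ _++_ (preds-rename f F) (preds-rename f G)
    preds-rename f (F ⇒ᶠ G)    = cong₂ _++_ (preds-rename f F) (preds-rename f G)
    preds-rename f (∀ᶠ x F)    = preds-rename _ F
    preds-rename f (∃ᶠ x F)    = preds-rename _ F

    Ren-rename : ∀ {f} → Tagged f → (F : Fm S) → Ren S f F (rename f F)
    Ren-rename tf (atom q ts) = ren-atom
    Ren-rename tf (t ≐ s)     = ren-eq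
    Ren-rename tf ⊥ᶠ          = ren-⊥
    Ren-rename tf (F ∧ᶠ G)    = ren-∧ (Ren-rename tf F) (Ren-rename tf G)
    Ren-rename tf (F ∨ᶠ G)    = ren-∨ (Ren-rename tf F) (Ren-rename tf G)
    Ren-rename tf (F ⇒ᶠ G)    = ren-⇒ (Ren-rename tf F) (Ren-rename tf G)
    Ren-rename tf (∀ᶠ x F)    =
      ren-∀ (λ z z∈ → Tagged-avoids tf x (proj₂ (∈-filter⁻ _ {xs = fv S F} z∈))) (Ren-rename (Tagged-bind x tf) F)
    Ren-rename tf (∃ᶠ x F)    =
      ren-∃ (λ z z∈ → Tagged-avoids tf x (proj₂ (∈-filter⁻ _ {xs = fv S F} z∈))) (Ren-rename (Tagged-bind x tf) F)

    mutual
      tvars-renT : (f : ℕ → ℕ) (t : Term S) {w : ℕ} → w ∈ tvars S (renT S f t) → Σ[ v ∈ ℕ ] v ∈ tvars S t × w ≡ f v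
      tvars-renT f (var x)    (here refl) = x , here refl , refl
      tvars-renT f (app g ts) w∈          = tsvars-renTs f ts w∈

      tsvars-renTs : ∀ {n} (f : ℕ → ℕ) (ts : Vec (Term S) n) {w : ℕ} → w ∈ tsvars S (renTs S f ts)
                   → Σ[ v ∈ ℕ ] v ∈ tsvars S ts × w ≡ f v
      tsvars-renTs f (t ∷ ts) w∈ with ∈-++⁻ (tvars S (renT S f t)) w∈
      ... | inj₁ w∈t  = let v , v∈ , eq = tvars-renT f t w∈t in v , ∈-++⁺ˡ v∈ , eq
      ... | inj₂ w∈ts = let v , v∈ , eq = tsvars-renTs f ts w∈ts in v , ∈-++⁺ʳ (tvars S t) v∈ , eq

    boundVars-rename : {Q : Set} {qa : Q → ℕ} (f : ℕ → ℕ) (F : Formula S Q qa) {w : ℕ}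
                     → w ∈ boundVars (rename f F) → Σ[ x ∈ ℕ ] w ≡ bound x
    boundVars-rename f (F ∧ᶠ G) w∈ with ∈-++⁻ (boundVars (rename f F)) w∈
    ... | inj₁ w∈F = boundVars-rename f F w∈F
    ... | inj₂ w∈G = boundVars-rename f G w∈G
    boundVars-rename f (F ∨ᶠ G) w∈ with ∈-++⁻ (boundVars (rename f F)) w∈
    ... | inj₁ w∈F = boundVars-rename f F w∈F
    ... | inj₂ w∈G = boundVars-rename f G w∈G
    boundVars-rename f (F ⇒ᶠ G) w∈ with ∈-++⁻ (boundVars (rename f F)) w∈
    ... | inj₁ w∈F = boundVars-rename f F w∈F
    ... | inj₂ w∈G = boundVars-rename f G w∈G
    boundVars-rename f (∀ᶠ x F) (here refl) = x , refl
    boundVars-rename f (∀ᶠ x F) (there w∈)  = boundVars-rename _ F w∈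
    boundVars-rename f (∃ᶠ x F) (here refl) = x , refl
    boundVars-rename f (∃ᶠ x F) (there w∈)  = boundVars-rename _ F w∈

    mutual
      fv-rename : {Q : Set} {qa : Q → ℕ} {f : ℕ → ℕ} → Tagged f → (F : Formula S Q qa) {w : ℕ}
                → w ∈ fv S (rename f F) → Σ[ v ∈ ℕ ] v ∈ fv S F × w ≡ f v
      fv-rename tf (atom q ts) w∈ = tsvars-renTs _ ts w∈
      fv-rename tf (t ≐ s)     w∈ with ∈-++⁻ (tvars S (renT S _ t)) w∈
      ... | inj₁ w∈t = let v , v∈ , eq = tvars-renT _ t w∈t in v , ∈-++⁺ˡ v∈ , eq
      ... | inj₂ w∈s = let v , v∈ , eq = tvars-renT _ s w∈s in v , ∈-++⁺ʳ (tvars S t) v∈ , eq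
      fv-rename tf (F ∧ᶠ G)    w∈ = fv-rename-++ tf F G w∈
      fv-rename tf (F ∨ᶠ G)    w∈ = fv-rename-++ tf F G w∈
      fv-rename tf (F ⇒ᶠ G)    w∈ = fv-rename-++ tf F G w∈
      fv-rename tf (∀ᶠ x F)    w∈ = fv-rename-binder tf x F w∈
      fv-rename tf (∃ᶠ x F)    w∈ = fv-rename-binder tf x F w∈

      fv-rename-++ : {Q : Set} {qa : Q → ℕ} {f : ℕ → ℕ} → Tagged f → (F G : Formula S Q qa) {w : ℕ}
                   → w ∈ fv S (rename f F) ++ fv S (rename f G) → Σ[ v ∈ ℕ ] v ∈ fv S F ++ fv S G × w ≡ f v
      fv-rename-++ tf F G w∈ with ∈-++⁻ (fv S (rename _ F)) w∈
      ... | inj₁ w∈F = let v , v∈ , eq = fv-rename tf F w∈F in v , ∈-++⁺ˡ v∈ , eq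
      ... | inj₂ w∈G = let v , v∈ , eq = fv-rename tf G w∈G in v , ∈-++⁺ʳ (fv S F) v∈ , eq

      fv-rename-binder : {Q : Set} {qa : Q → ℕ} {f : ℕ → ℕ} → Tagged f → (x : ℕ) (F : Formula S Q qa) {w : ℕ}
                       → w ∈ removeℕ (bound x) (fv S (rename (f [ x ↦ bound x ]) F))
                       → Σ[ v ∈ ℕ ] v ∈ removeℕ x (fv S F) × w ≡ f v
      fv-rename-binder {f = f} tf x F w∈ with ∈-filter⁻ _ {xs = fv S (rename (f [ x ↦ bound x ]) F)} w∈
      ... | w∈F , w≢bx with fv-rename (Tagged-bind x tf) F w∈F
      ...   | v , v∈ , eq with v ≟ℕ x
      ...     | yes refl = ⊥-elim (w≢bx eq)
      ...     | no v≢x   = v , ∈-filter⁺ _ v∈ v≢x , eq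

    free∉boundVars-rename : {Q : Set} {qa : Q → ℕ} (f : ℕ → ℕ) (F : Formula S Q qa) (v : ℕ)
                          → free v ∉ boundVars (rename f F)
    free∉boundVars-rename f F v free∈ = let x , free≡ = boundVars-rename f F free∈ in free≢bound v x free≡

    fv-rename-free∉boundVars : {Q : Set} {qa : Q → ℕ} (F : Formula S Q qa) {w : ℕ}
                             → w ∈ fv S (rename free F) → w ∉ boundVars (rename free F)
    fv-rename-free∉boundVars F w∈fv w∈bv =
      let v , _ , w≡ = fv-rename Tagged-free F w∈fv
      in free∉boundVars-rename free F v (subst (_∈ boundVars (rename free F)) w≡ w∈bv)

    Tagged-FreeOrBound : ∀ {f v w} → Tagged f → w ≡ f v → FreeOrBound v w
    Tagged-FreeOrBound {v = v} tf w≡ = subst (FreeOrBound v) (sym w≡) (tf v)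

    mutual
      allvars-rename : {f : ℕ → ℕ} → Tagged f → (F : Fm S) {w : ℕ} → w ∈ allvars S (rename f F)
                     → Σ[ v ∈ ℕ ] v ∈ allvars S F × FreeOrBound v w
      allvars-rename tf (atom q ts) w∈ =
        let v , v∈ , w≡ = tsvars-renTs _ ts w∈ in v , v∈ , Tagged-FreeOrBound tf w≡
      allvars-rename tf (t ≐ s) w∈ with ∈-++⁻ (tvars S (renT S _ t)) w∈
      ... | inj₁ w∈t = let v , v∈ , w≡ = tvars-renT _ t w∈t in v , ∈-++⁺ˡ v∈ , Tagged-FreeOrBound tf w≡
      ... | inj₂ w∈s = let v , v∈ , w≡ = tvars-renT _ s w∈s in v , ∈-++⁺ʳ (tvars S t) v∈ , Tagged-FreeOrBound tf w≡
      allvars-rename tf (F ∧ᶠ G) w∈ = allvars-rename-++ tf F G w∈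
      allvars-rename tf (F ∨ᶠ G) w∈ = allvars-rename-++ tf F G w∈
      allvars-rename tf (F ⇒ᶠ G) w∈ = allvars-rename-++ tf F G w∈
      allvars-rename tf (∀ᶠ x F) (here refl) = x , here refl , inj₂ refl
      allvars-rename tf (∀ᶠ x F) (there w∈)  =
        let v , v∈ , w≡ = allvars-rename (Tagged-bind x tf) F w∈ in v , there v∈ , w≡
      allvars-rename tf (∃ᶠ x F) (here refl) = x , here refl , inj₂ refl
      allvars-rename tf (∃ᶠ x F) (there w∈)  =
        let v , v∈ , w≡ = allvars-rename (Tagged-bind x tf) F w∈ in v , there v∈ , w≡

      allvars-rename-++ : {f : ℕ → ℕ} → Tagged f → (F G : Fm S) {w : ℕ}
                        → w ∈ allvars S (rename f F) ++ allvars S (rename f G)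
                        → Σ[ v ∈ ℕ ] v ∈ allvars S F ++ allvars S G × FreeOrBound v w
      allvars-rename-++ tf F G w∈ with ∈-++⁻ (allvars S (rename _ F)) w∈
      ... | inj₁ w∈F = let v , v∈ , w≡ = allvars-rename tf F w∈F in v , ∈-++⁺ˡ v∈ , w≡
      ... | inj₂ w∈G = let v , v∈ , w≡ = allvars-rename tf G w∈G in v , ∈-++⁺ʳ (allvars S F) v∈ , w≡

    module _ (M : Structure S) where
      open Structure M
      open Semantics M
      open Equivalence

      mutual
        evalT-renT : (f : ℕ → ℕ) (τ : ℕ → D) (t : Term S) → evalT S M τ (renT S f t) ≡ evalT S M (τ ∘ f) t
        evalT-renT f τ (var x)    = refl
        evalT-renT f τ (app g ts) = cong (funI g) (evalTs-renTs f τ ts)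

        evalTs-renTs : ∀ {n} (f : ℕ → ℕ) (τ : ℕ → D) (ts : Vec (Term S) n)
                     → evalTs S M τ (renTs S f ts) ≡ evalTs S M (τ ∘ f) ts
        evalTs-renTs f τ []       = refl
        evalTs-renTs f τ (t ∷ ts) = cong₂ _∷_ (evalT-renT f τ t) (evalTs-renTs f τ ts)

      module _ {f : ℕ → ℕ} {σ τ : ℕ → D} (σ≗τ∘f : ∀ v → σ v ≡ τ (f v)) where

        evalT-renT-≗ : (t : Term S) → evalT S M τ (renT S f t) ≡ evalT S M σ t
        evalT-renT-≗ t = trans (evalT-renT f τ t) (evalT-cong t (τ ∘ f) σ (λ v _ → sym (σ≗τ∘f v)))

        evalTs-renTs-≗ : ∀ {n} (ts : Vec (Term S) n) → evalTs S M τ (renTs S f ts) ≡ evalTs S M σ ts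
        evalTs-renTs-≗ ts = trans (evalTs-renTs f τ ts) (evalTs-cong ts (τ ∘ f) σ (λ v _ → sym (σ≗τ∘f v)))

        ≗-bind : Tagged f → (x : ℕ) (d : D) → ∀ v → (σ [ x ↦ d ]) v ≡ (τ [ bound x ↦ d ]) ((f [ x ↦ bound x ]) v)
        ≗-bind tf x d v with v ≟ℕ x
        ... | yes refl = sym ([↦]-same τ (bound v) d)
        ... | no v≢x   = trans (σ≗τ∘f v) (sym ([↦]-other τ (bound x) d (Tagged-avoids tf x v≢x)))

      evalTs-renTs-free : ∀ {n} (σ : ℕ → D) (ts : Vec (Term S) n) → evalTs S M (σ ∘ decode) (renTs S free ts) ≡ evalTs S M σ ts
      evalTs-renTs-free σ = evalTs-renTs-≗ (λ v → cong σ (sym (decode-free v)))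

      evalF-rename : {Q : Set} {qa : Q → ℕ} (R : Interp Q qa) {f : ℕ → ℕ} → Tagged f → (F : Formula S Q qa)
                   → (σ τ : ℕ → D) → (∀ v → σ v ≡ τ (f v)) → evalF S M R τ (rename f F) ⇔ evalF S M R σ F
      evalF-rename R tf (atom q ts) σ τ σ≗ =
        mk⇔ (subst (R q) (evalTs-renTs-≗ σ≗ ts)) (subst (R q) (sym (evalTs-renTs-≗ σ≗ ts)))
      evalF-rename R tf (t ≐ s) σ τ σ≗ =
        mk⇔ (λ eq → trans (sym (evalT-renT-≗ σ≗ t)) (trans eq (evalT-renT-≗ σ≗ s)))
            (λ eq → trans (evalT-renT-≗ σ≗ t) (trans eq (sym (evalT-renT-≗ σ≗ s))))
      evalF-rename R tf ⊥ᶠ σ τ σ≗ = mk⇔ id id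
      evalF-rename R tf (F ∧ᶠ G) σ τ σ≗ =
        mk⇔ (Data.Product.map (to F⇔) (to G⇔)) (Data.Product.map (from F⇔) (from G⇔))
        where F⇔ = evalF-rename R tf F σ τ σ≗
              G⇔ = evalF-rename R tf G σ τ σ≗
      evalF-rename R tf (F ∨ᶠ G) σ τ σ≗ =
        mk⇔ (Data.Sum.map (to F⇔) (to G⇔)) (Data.Sum.map (from F⇔) (from G⇔))
        where F⇔ = evalF-rename R tf F σ τ σ≗
              G⇔ = evalF-rename R tf G σ τ σ≗
      evalF-rename R tf (F ⇒ᶠ G) σ τ σ≗ =
        mk⇔ (λ g → to G⇔ ∘ g ∘ from F⇔) (λ g → from G⇔ ∘ g ∘ to F⇔)
        where F⇔ = evalF-rename R tf F σ τ σ≗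
              G⇔ = evalF-rename R tf G σ τ σ≗
      evalF-rename R tf (∀ᶠ x F) σ τ σ≗ =
        mk⇔ (λ g d → to (F⇔ d) (g d)) (λ g d → from (F⇔ d) (g d))
        where F⇔ = λ d → evalF-rename R (Tagged-bind x tf) F (σ [ x ↦ d ]) (τ [ bound x ↦ d ]) (≗-bind σ≗ tf x d)
      evalF-rename R tf (∃ᶠ x F) σ τ σ≗ =
        mk⇔ (λ (d , a) → d , to (F⇔ d) a) (λ (d , a) → d , from (F⇔ d) a)
        where F⇔ = λ d → evalF-rename R (Tagged-bind x tf) F (σ [ x ↦ d ]) (τ [ bound x ↦ d ]) (≗-bind σ≗ tf x d)

      evalF-rename-free : {Q : Set} {qa : Q → ℕ} (R : Interp Q qa) (F : Formula S Q qa) (σ : ℕ → D)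
                        → evalF S M R (σ ∘ decode) (rename free F) ⇔ evalF S M R σ F
      evalF-rename-free R F σ = evalF-rename R Tagged-free F σ (σ ∘ decode) (λ v → cong σ (sym (decode-free v)))

  fvRule⊆varsRule : (r : Rule S) → fvRule S r ⊆ varsRule S r
  fvRule⊆varsRule r v∈ with ∈-++⁻ (tsvars S (args r)) (∈-deduplicate⁻ _≟ℕ_ (tsvars S (args r) ++ fv S (body r)) v∈)
  ... | inj₁ v∈args = ∈-++⁺ˡ v∈args
  ... | inj₂ v∈body = ∈-++⁺ʳ (tsvars S (args r)) (fv⊆allvars (body r) v∈body)

  fv-body⊆fvRule : (r : Rule S) → fv S (body r) ⊆ fvRule S r
  fv-body⊆fvRule r = ∈-deduplicate⁺ _≟ℕ_ ∘ ∈-++⁺ʳ (tsvars S (args r))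

  args⊆fvRule : (r : Rule S) → tsvars S (args r) ⊆ fvRule S r
  args⊆fvRule r = ∈-deduplicate⁺ _≟ℕ_ ∘ ∈-++⁺ˡ

  ≤-foldr-⊔ : (xs : List ℕ) {v : ℕ} → v ∈ xs → v ≤ foldr _⊔_ 0 xs
  ≤-foldr-⊔ (x ∷ xs) (here refl) = m≤m⊔n x _
  ≤-foldr-⊔ (x ∷ xs) (there v∈)  = ≤-trans (≤-foldr-⊔ xs v∈) (m≤n⊔m x _)

  varsRule<freshBase : (Π : Program S) {r : Rule S} → r ∈ Π → ∀ {v} → v ∈ varsRule S r → v < freshBase S Π
  varsRule<freshBase Π r∈Π v∈ =
    s≤s (≤-foldr-⊔ (concatMap (varsRule S) Π) (∈-concatMap⁺ (varsRule S) (Any.map (λ { refl → v∈ }) r∈Π)))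

  tsvars-map-var-tabulate : ∀ {n} (g : Fin n → ℕ) {v : ℕ} → v ∈ tsvars S (V.map var (V.tabulate g)) → Σ[ i ∈ Fin n ] v ≡ g i
  tsvars-map-var-tabulate {suc n} g (here refl) = zero , refl
  tsvars-map-var-tabulate {suc n} g (there v∈)  = let i , v≡ = tsvars-map-var-tabulate (g ∘ suc) v∈ in suc i , v≡

  freshVars∉fvRule : (Π : Program S) (p : Pr) {r : Rule S} → r ∈ Π
                   → ∀ {v} → v ∈ tsvars S (V.map var (freshVars S Π p)) → v ∉ fvRule S r
  freshVars∉fvRule Π p {r} r∈Π v∈ v∈r =
    let i , v≡ = tsvars-map-var-tabulate {pa p} (λ i → freshBase S Π + toℕ i) v∈
    in n≮n _ (<-≤-trans (varsRule<freshBase Π r∈Π (fvRule⊆varsRule r v∈r))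
                        (subst (freshBase S Π ≤_) (sym v≡) (m≤m+n (freshBase S Π) (toℕ i))))

  HeadArgs : Pr → Set
  HeadArgs q = Vec (Term S) (pa q)

  ∈-rulesFor⁻ : (p : Pr) (Π : Program S) {x : HeadArgs p × Fm S × List ℕ} → x ∈ rulesFor S p Π
              → Σ[ r ∈ Rule S ] r ∈ Π × Σ[ e ∈ hd r ≡ p ] x ≡ (subst HeadArgs e (args r) , body r , fvRule S r)
  ∈-rulesFor⁻ p (r ∷ Π) x∈ with hd r ≟P p
  ∈-rulesFor⁻ p (r ∷ Π) (here refl) | yes e = r , here refl , e , refl
  ∈-rulesFor⁻ p (r ∷ Π) (there x∈)  | yes _ = let r' , r'∈ , rest = ∈-rulesFor⁻ p Π x∈ in r' , there r'∈ , rest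
  ∈-rulesFor⁻ p (r ∷ Π) x∈          | no _  = let r' , r'∈ , rest = ∈-rulesFor⁻ p Π x∈ in r' , there r'∈ , rest

  ∈-rulesFor⁺ : (Π : Program S) {r : Rule S} → r ∈ Π
              → (args r , body r , fvRule S r) ∈ rulesFor S (hd r) Π
  ∈-rulesFor⁺ (r' ∷ Π) {r} r∈ with hd r' ≟P hd r
  ∈-rulesFor⁺ (r' ∷ Π) (here refl) | yes refl = here refl
  ∈-rulesFor⁺ (r' ∷ Π) (here refl) | no ne    = ⊥-elim (ne refl)
  ∈-rulesFor⁺ (r' ∷ Π) (there r∈)  | yes _    = there (∈-rulesFor⁺ Π r∈)
  ∈-rulesFor⁺ (r' ∷ Π) (there r∈)  | no _     = ∈-rulesFor⁺ Π r∈

  preds-foralls : (xs : List ℕ) (F : Fm S) → preds S (foralls S xs F) ≡ preds S F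
  preds-foralls []       F = refl
  preds-foralls (x ∷ xs) F = preds-foralls xs F

  preds-conj : (Fs : List (Fm S)) {F : Fm S} → F ∈ Fs → preds S F ⊆ preds S (conj S Fs)
  preds-conj (F ∷ [])     (here refl) = id
  preds-conj (F ∷ G ∷ Fs) (here refl) = ∈-++⁺ˡ
  preds-conj (F ∷ G ∷ Fs) (there F∈)  = ∈-++⁺ʳ (preds S F) ∘ preds-conj (G ∷ Fs) F∈

  preds-rule⊆predsΠ : (Π : Program S) {r : Rule S} → r ∈ Π → preds S (body r ⇒ᶠ atom (hd r) (args r)) ⊆ predsΠ S Π
  preds-rule⊆predsΠ Π {r} r∈Π {p} p∈ =
    ∈-deduplicate⁺ _≟P_ (preds-conj (L.map (ruleFormula S) Π) (∈-map⁺ (ruleFormula S) r∈Π)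
      (subst (p ∈_) (sym (preds-foralls (dedupℕ (fv S (body r ⇒ᶠ atom (hd r) (args r)))) (body r ⇒ᶠ atom (hd r) (args r)))) p∈))

  hd∈predsΠ : (Π : Program S) {r : Rule S} → r ∈ Π → hd r ∈ predsΠ S Π
  hd∈predsΠ Π {r} r∈Π = preds-rule⊆predsΠ Π r∈Π (∈-++⁺ʳ (preds S (body r)) (here refl))

  preds-body⊆predsΠ : (Π : Program S) {r : Rule S} → r ∈ Π → preds S (body r) ⊆ predsΠ S Π
  preds-body⊆predsΠ Π r∈Π = preds-rule⊆predsΠ Π r∈Π ∘ ∈-++⁺ˡ

  supportDisjunct : ∀ {n} → Vec ℕ n → Vec (Term S) n × Fm S × List ℕ → Fm S
  supportDisjunct xs (ts , G , ys) = exists S ys (conj S (eqsL S (V.map var xs) ts ++ G ∷ []))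

  supportOf : Program S → Pr → Fm S
  supportOf Π p = disj S (L.map (supportDisjunct (freshVars S Π p)) (rulesFor S p Π))

  completedBody : Program S → Pr → Fm S
  completedBody Π p = _⇔ᶠ_ S (atom p (V.map var (freshVars S Π p))) (supportOf Π p)

  module _ (Π : Program S) where

    blockWidth : ℕ
    blockWidth = 2 * freshBase S Π

    renameRule : ℕ → Rule S → Rule S
    renameRule k r = rule (hd r) (renTs S free (args r)) (rename free (body r))
      where open Block (k * blockWidth)

    renameRule-Vertex : (k : ℕ) {r : Rule S} → r ∈ Π → Vertex S Π (renameRule k r)
    renameRule-Vertex k {r} r∈Π =
      r , r∈Π , free , rename free (body r) , (λ _ _ _ _ → free-injective) , Ren-rename Tagged-free (body r) , refl
      where open Block (k * blockWidth)

    varsRule-renameRule : (k : ℕ) {r : Rule S} → r ∈ Π → ∀ {w} → w ∈ varsRule S (renameRule k r)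
                        → Σ[ u ∈ ℕ ] u < blockWidth × w ≡ k * blockWidth + u
    varsRule-renameRule k {r} r∈Π {w} w∈ = locate (∈-++⁻ (tsvars S (renTs S free (args r))) w∈)
      where
      open Block (k * blockWidth)

      body< : ∀ {v} → v ∈ allvars S (body r) → v < freshBase S Π
      body< = varsRule<freshBase Π r∈Π ∘ ∈-++⁺ʳ (tsvars S (args r))

      locate : w ∈ tsvars S (renTs S free (args r)) ⊎ w ∈ allvars S (rename free (body r))
             → Σ[ u ∈ ℕ ] u < blockWidth × w ≡ k * blockWidth + u
      locate (inj₁ w∈args) with tsvars-renTs free (args r) w∈args
      ... | v , v∈ , w≡ = 2 * v , <-trans (n<1+n _) (1+2*m<2*n (varsRule<freshBase Π r∈Π (∈-++⁺ˡ v∈))) , w≡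
      locate (inj₂ w∈body) with allvars-rename Tagged-free (body r) w∈body
      ... | v , v∈ , inj₁ w≡ = 2 * v , <-trans (n<1+n _) (1+2*m<2*n (body< v∈)) , w≡
      ... | v , v∈ , inj₂ w≡ = suc (2 * v) , 1+2*m<2*n (body< v∈) , w≡

    block-varsRule-renameRule : (k : ℕ) {r : Rule S} → r ∈ Π → ∀ {w} → w ∈ varsRule S (renameRule k r)
                              → w / blockWidth ≡ k
    block-varsRule-renameRule k r∈Π w∈ =
      let u , u< , w≡ = varsRule-renameRule k r∈Π w∈
      in trans (cong (_/ blockWidth) w≡) ([k*n+u]/n≡k k blockWidth u u<)

  module _ (M : Structure S) where
    open Structure M
    open Semantics M

    GroundAtom : Set
    GroundAtom = Σ Pr λ q → Vec D (pa q)

    Gap : Rels S M → GroundAtom → Set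
    Gap U (q , d) = relI q d × ¬ U q d

    -- ρ' is the assignment reached at the atom after descending through the quantifiers of F.
    record PositiveGap (U : Rels S M) (F : Fm S) (ρ : ℕ → D) : Set where
      field
        occ   : Occ S
        occ∈  : occ ∈ posNN S true F
        ρ'    : ℕ → D
        ρ'≈ρ  : ∀ v → v ∉ boundVars F → ρ' v ≡ ρ v
        gap   : Gap U (proj₁ occ , evalTs S M ρ' (proj₂ occ))

    positiveGap-lift : {U : Rels S M} {F G : Fm S} {ρ₀ ρ : ℕ → D} → PositiveGap U F ρ₀
                     → posNN S true F ⊆ posNN S true G → boundVars F ⊆ boundVars G
                     → (∀ v → v ∉ boundVars G → ρ₀ v ≡ ρ v) → PositiveGap U G ρ
    positiveGap-lift g F⊆G bvF⊆bvG ρ₀≈ρ = record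
      { occ = occ ; occ∈ = F⊆G occ∈ ; ρ' = ρ' ; gap = gap
      ; ρ'≈ρ = λ v v∉ → trans (ρ'≈ρ v (v∉ ∘ bvF⊆bvG)) (ρ₀≈ρ v v∉) }
      where open PositiveGap g

    module _ (em : ExcludedMiddle lzero) (U : Rels S M) where

      positiveGap : (F : Fm S) (ρ : ℕ → D) → _≤[_]_ S M U (preds S F) relI
                  → evalF S M relI ρ F → ¬ evalF S M (withU S M U) ρ (star S F) → PositiveGap U F ρ
      positiveGap (atom p ts) ρ _ a ¬a* = record
        { occ = p , ts ; occ∈ = here refl ; ρ' = ρ ; ρ'≈ρ = λ _ _ → refl ; gap = a , ¬a* }
      positiveGap (t ≐ s) ρ _ a ¬a* = ⊥-elim (¬a* a)
      positiveGap (F ∧ᶠ G) ρ U≤I (a , b) ¬ab* with em {evalF S M (withU S M U) ρ (star S F)}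
      ... | yes a* = positiveGap-lift
                       (positiveGap G ρ (All.++⁻ʳ (preds S F) U≤I) b (λ b* → ¬ab* (a* , b*)))
                       (∈-++⁺ʳ _) (∈-++⁺ʳ _) (λ _ _ → refl)
      ... | no ¬a* = positiveGap-lift (positiveGap F ρ (All.++⁻ˡ (preds S F) U≤I) a ¬a*)
                       ∈-++⁺ˡ ∈-++⁺ˡ (λ _ _ → refl)
      positiveGap (F ∨ᶠ G) ρ U≤I (inj₁ a) ¬ab* =
        positiveGap-lift (positiveGap F ρ (All.++⁻ˡ (preds S F) U≤I) a (¬ab* ∘ inj₁)) ∈-++⁺ˡ ∈-++⁺ˡ (λ _ _ → refl)
      positiveGap (F ∨ᶠ G) ρ U≤I (inj₂ b) ¬ab* =
        positiveGap-lift (positiveGap G ρ (All.++⁻ʳ (preds S F) U≤I) b (¬ab* ∘ inj₂))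
          (∈-++⁺ʳ _) (∈-++⁺ʳ _) (λ _ _ → refl)
      positiveGap (F ⇒ᶠ G) ρ U≤I f ¬f* with posNN-⇒ true F G
      ... | inj₁ refl =
        ⊥-elim (¬f* ((f ∘ evalF-star⇒evalF U F ρ (All.++⁻ˡ (preds S F) U≤I)) , (f ∘ evalF-embed⁻ U F ρ)))
      ... | inj₂ eq with em {evalF S M (withU S M U) ρ (star S F)}
      ...   | no ¬a* = ⊥-elim (¬f* ((⊥-elim ∘ ¬a*) , (evalF-embed⁺ U G ρ ∘ f ∘ evalF-embed⁻ U F ρ)))
      ...   | yes a* = positiveGap-lift
                         (positiveGap G ρ (All.++⁻ʳ (preds S F) U≤I)
                           (f (evalF-star⇒evalF U F ρ (All.++⁻ˡ (preds S F) U≤I) a*))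
                           (λ b* → ¬f* ((λ _ → b*) , (evalF-embed⁺ U G ρ ∘ f ∘ evalF-embed⁻ U F ρ))))
                         (λ o∈ → subst (_ ∈_) (sym eq) (∈-++⁺ʳ _ o∈)) (∈-++⁺ʳ _) (λ _ _ → refl)
      positiveGap (∀ᶠ x F) ρ U≤I f ¬f* =
        let d , ¬a* = ¬∀⇒∃¬ em ¬f*
        in positiveGap-lift (positiveGap F (ρ [ x ↦ d ]) U≤I (f d) ¬a*) id there
             (λ v v∉ → [↦]-other ρ x d (v∉ ∘ here))
      positiveGap (∃ᶠ x F) ρ U≤I (d , a) ¬a* =
        positiveGap-lift (positiveGap F (ρ [ x ↦ d ]) U≤I a (¬a* ∘ (d ,_))) id there
          (λ v v∉ → [↦]-other ρ x d (v∉ ∘ here))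

    module _ (Π : Program S) where

      private
        ruleImp : Rule S → Fm S
        ruleImp r = body r ⇒ᶠ atom (hd r) (args r)

        closureVars : Rule S → List ℕ
        closureVars r = dedupℕ (fv S (ruleImp r))

        xs : (p : Pr) → Vec (Term S) (pa p)
        xs p = V.map var (freshVars S Π p)

      Sat-rule : Sat S M (progFormula S Π) → {r : Rule S} → r ∈ Π
               → ∀ ρ → evalF S M relI ρ (body r) → relI (hd r) (evalTs S M ρ (args r))
      Sat-rule SatΠ {r} r∈Π ρ =
        evalF-foralls⁻ relI (closureVars r) (ruleImp r) ρ
          (Sat-conj⁻ (L.map (ruleFormula S) Π) SatΠ (∈-map⁺ (ruleFormula S) r∈Π) ρ)

      star-rule : (U : Rels S M) → (∀ ρ → evalF S M (withU S M U) ρ (star S (progFormula S Π))) → {r : Rule S} → r ∈ Π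
                → ∀ ρ → evalF S M (withU S M U) ρ (star S (body r)) → U (hd r) (evalTs S M ρ (args r))
      star-rule U Π* {r} r∈Π ρ =
        proj₁ (evalF-foralls⁻ (withU S M U) (closureVars r) (star S (ruleImp r)) ρ
                (subst (evalF S M (withU S M U) ρ) (star-foralls (closureVars r) (ruleImp r))
                  (All.lookup (evalF-star-conj⁻ (withU S M U) (L.map (ruleFormula S) Π) ρ (Π* ρ))
                              (∈-map⁺ (ruleFormula S) r∈Π))))

      star-progFormula⁺ : (U : Rels S M)
                        → (∀ {r} → r ∈ Π → ∀ ρ → evalF S M (withU S M U) ρ (star S (ruleImp r)))
                        → ∀ ρ → evalF S M (withU S M U) ρ (star S (progFormula S Π))
      star-progFormula⁺ U rules* ρ =
        evalF-star-conj⁺ (withU S M U) (L.map (ruleFormula S) Π) ρ (All.map⁺ (All.tabulate λ {r} r∈Π →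
          subst (λ F → evalF S M (withU S M U) ρ F) (sym (star-foralls (closureVars r) (ruleImp r)))
            (evalF-foralls⁺ (withU S M U) (closureVars r) (star S (ruleImp r)) (rules* r∈Π) ρ)))

      Comp-completedBody : Sat S M (Comp S Π) → {p : Pr} → p ∈ predsΠ S Π → ∀ ρ → evalF S M relI ρ (completedBody Π p)
      Comp-completedBody SatComp {p} p∈ ρ =
        evalF-foralls⁻ relI (toList (freshVars S Π p)) (completedBody Π p) ρ
          (Sat-conj⁻ (L.map (compDef S Π) (predsΠ S Π)) SatComp (∈-map⁺ (compDef S Π) p∈) ρ)

      completedBody-Comp : (∀ {p} → p ∈ predsΠ S Π → ∀ ρ → evalF S M relI ρ (completedBody Π p)) → Sat S M (Comp S Π)
      completedBody-Comp bodies = Sat-conj⁺ (L.map (compDef S Π) (predsΠ S Π)) λ F∈ →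
        let p , p∈ , F≡ = ∈-map⁻ (compDef S Π) F∈
        in subst (Sat S M) (sym F≡) (evalF-foralls⁺ relI (toList (freshVars S Π p)) (completedBody Π p) (bodies p∈))

      supportOf⁺ : {r : Rule S} → r ∈ Π → {p : Pr} (ρr ρc : ℕ → D) → evalF S M relI ρr (body r)
                 → _≡_ {A = GroundAtom} (hd r , evalTs S M ρr (args r)) (p , evalTs S M ρc (xs p))
                 → evalF S M relI ρc (supportOf Π p)
      supportOf⁺ {r} r∈Π ρr ρc holds eq with Σ-≡,≡←≡ eq
      ... | refl , args≡xs =
        evalF-disj⁺ relI _ ρc (Any.map⁺ (lose (∈-rulesFor⁺ Π r∈Π)
          (evalF-exists⁺ relI (fvRule S r) _ σ ρc (λ v → override-∉ (fvRule S r) ρr ρc)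
            (evalF-conj⁺ relI _ σ (All.++⁺ (evalF-eqsL⁺ relI (xs (hd r)) (args r) σ xs≡args) (holdsσ ∷ []))))))
        where
        σ : ℕ → D
        σ = override (fvRule S r) ρr ρc

        σ≈ρr : ∀ {v} → v ∈ fvRule S r → ρr v ≡ σ v
        σ≈ρr v∈ = sym (override-∈ (fvRule S r) ρr ρc v∈)

        holdsσ : evalF S M relI σ (body r)
        holdsσ = evalF-cong relI (body r) ρr σ (λ v → σ≈ρr ∘ fv-body⊆fvRule r) holds

        xs≡args : evalTs S M σ (xs (hd r)) ≡ evalTs S M σ (args r)
        xs≡args = begin
          evalTs S M σ (xs (hd r))  ≡⟨ evalTs-cong (xs (hd r)) σ ρc (λ v v∈ → override-∉ (fvRule S r) ρr ρc
                                                                            (freshVars∉fvRule Π (hd r) r∈Π v∈)) ⟩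
          evalTs S M ρc (xs (hd r)) ≡⟨ sym args≡xs ⟩
          evalTs S M ρr (args r)    ≡⟨ evalTs-cong (args r) ρr σ (λ v → σ≈ρr ∘ args⊆fvRule r) ⟩
          evalTs S M σ (args r)     ∎
          where open ≡-Reasoning

      record Derivation (a : GroundAtom) : Set where
        constructor derivation
        field
          r     : Rule S
          r∈Π   : r ∈ Π
          σ     : ℕ → D
          holds : evalF S M relI σ (body r)
          head≡ : (hd r , evalTs S M σ (args r)) ≡ a

      supportOf⁻ : (p : Pr) (ρ : ℕ → D) → evalF S M relI ρ (supportOf Π p) → Derivation (p , evalTs S M ρ (xs p))
      supportOf⁻ p ρ holds with find (Any.map⁻ (evalF-disj⁻ relI _ ρ holds))
      ... | _ , x∈ , disjunct with ∈-rulesFor⁻ p Π x∈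
      ...   | r , r∈Π , refl , refl with evalF-exists⁻ relI (fvRule S r) _ ρ disjunct
      ...     | σ , σ≈ρ , conjunction with All.++⁻ (eqsL S (xs (hd r)) (args r)) (evalF-conj⁻ relI _ σ conjunction)
      ...       | eqs , holds ∷ [] = derivation r r∈Π σ holds (cong (hd r ,_) (begin
        evalTs S M σ (args r)     ≡⟨ sym (evalF-eqsL⁻ relI (xs (hd r)) (args r) σ eqs) ⟩
        evalTs S M σ (xs (hd r))  ≡⟨ evalTs-cong (xs (hd r)) σ ρ (λ v v∈ → σ≈ρ v (freshVars∉fvRule Π (hd r) r∈Π v∈)) ⟩
        evalTs S M ρ (xs (hd r))  ∎))
        where open ≡-Reasoning

      freshAssignment : (p : Pr) (d : Vec D (pa p)) → Σ[ ρ ∈ (ℕ → D) ] evalTs S M ρ (xs p) ≡ d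
      freshAssignment p d = ρ , (begin
        evalTs S M ρ (xs p)                           ≡⟨ evalTs-map-var ρ (freshVars S Π p) ⟩
        V.map ρ (V.tabulate (λ i → base + toℕ i))    ≡⟨ sym (tabulate-∘ ρ (λ i → base + toℕ i)) ⟩
        V.tabulate (λ i → ρ (base + toℕ i))          ≡⟨ tabulate-cong (λ i → trans (cong (lookupOr d₀ d) (m+n∸m≡n base (toℕ i)))
                                                                                      (lookupOr-toℕ d₀ d i)) ⟩
        V.tabulate (V.lookup d)                       ≡⟨ tabulate∘lookup d ⟩
        d                                             ∎)
        where
        open ≡-Reasoning
        base = freshBase S Π
        ρ : ℕ → D
        ρ w = lookupOr d₀ d (w ∸ base)

      Comp⇒Π : Sat S M (Comp S Π) → Sat S M (progFormula S Π)
      Comp⇒Π SatComp = Sat-conj⁺ (L.map (ruleFormula S) Π) λ F∈ →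
        let r , r∈Π , F≡ = ∈-map⁻ (ruleFormula S) F∈
        in subst (Sat S M) (sym F≡) (evalF-foralls⁺ relI (closureVars r) (ruleImp r) λ ρ holds →
             let ρc , xs≡ = freshAssignment (hd r) (evalTs S M ρ (args r))
                 supported = supportOf⁺ r∈Π ρ ρc holds (cong (hd r ,_) (sym xs≡))
             in subst (relI (hd r)) xs≡ (proj₂ (Comp-completedBody SatComp (hd∈predsΠ Π r∈Π) ρc) supported))

      -- Stable models satisfy the completion

      withoutAtom : GroundAtom → Rels S M
      withoutAtom a q d = relI q d × (q , d) ≢ a

      withoutAtom-star : Sat S M (progFormula S Π) → {p : Pr} (ρ : ℕ → D) → ¬ evalF S M relI ρ (supportOf Π p)
                       → ∀ ρ' → evalF S M (withU S M (withoutAtom (p , evalTs S M ρ (xs p)))) ρ' (star S (progFormula S Π))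
      withoutAtom-star SatΠ {p} ρ unsupported = star-progFormula⁺ U λ {r} r∈Π ρ' →
        (λ body* → let holds = evalF-star⇒evalF U (body r) ρ' (All.tabulate λ _ _ → proj₁) body*
                   in Sat-rule SatΠ r∈Π ρ' holds , unsupported ∘ supportOf⁺ r∈Π ρ' ρ holds) ,
        (Sat-rule SatΠ r∈Π ρ' ∘ evalF-embed⁻ U (body r) ρ')
        where U = withoutAtom (p , evalTs S M ρ (xs p))

      SM⇒Comp : ExcludedMiddle lzero → SatSM S M (progFormula S Π) → Sat S M (Comp S Π)
      SM⇒Comp em (SatΠ , minimal) = completedBody-Comp λ {p} p∈ ρ → supported p∈ ρ , derived p ρ
        where
        supported : ∀ {p} → p ∈ predsΠ S Π → ∀ ρ → relI p (evalTs S M ρ (xs p)) → evalF S M relI ρ (supportOf Π p)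
        supported {p} p∈ ρ a with em {evalF S M relI ρ (supportOf Π p)}
        ... | yes s          = s
        ... | no unsupported = ⊥-elim (minimal (withoutAtom (p , evalTs S M ρ (xs p)) , All.tabulate (λ _ _ → proj₁) ,
                                                (λ I≤U → proj₂ (All.lookup I≤U p∈ _ a) refl) ,
                                                withoutAtom-star SatΠ ρ unsupported))

        derived : ∀ p ρ → evalF S M relI ρ (supportOf Π p) → relI p (evalTs S M ρ (xs p))
        derived p ρ s = let open Derivation (supportOf⁻ p ρ s)
                        in subst (λ (q , d) → relI q d) head≡ (Sat-rule SatΠ r∈Π σ holds)

      -- Under tightness, models of the completion are stable

      Comp-derivation : Sat S M (Comp S Π) → {p : Pr} {d : Vec D (pa p)} → p ∈ predsΠ S Π → relI p d → Derivation (p , d)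
      Comp-derivation SatComp {p} {d} p∈ a =
        let ρ , xs≡d = freshAssignment p d
            open Derivation (supportOf⁻ p ρ (proj₁ (Comp-completedBody SatComp p∈ ρ) (subst (relI p) (sym xs≡d) a)))
        in derivation r r∈Π σ holds (trans head≡ (cong (p ,_) xs≡d))

      relabel : {p : Pr} {u : Vec D (pa p)} (o : Occ S) (θ : ℕ → D) → (p , u) ≡ (proj₁ o , evalTs S M θ (proj₂ o))
              → Σ[ s ∈ HeadArgs p ] (p , s) ≡ o × tsvars S s ≡ tsvars S (proj₂ o) × evalTs S M θ s ≡ u
      relabel o θ refl = proj₂ o , refl , refl , refl

      Unfounded : Rels S M → GroundAtom → Set
      Unfounded U (q , d) = q ∈ predsΠ S Π × Gap U (q , d)

      record Step (U : Rels S M) (k : ℕ) (a : GroundAtom) : Set where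
        field
          r     : Rule S
          r∈Π   : r ∈ Π
          θ     : ℕ → D
          holds : evalF S M relI θ (body (renameRule Π k r))
          head≡ : (hd r , evalTs S M θ (args (renameRule Π k r))) ≡ a
          occ   : Occ S
          occ∈  : occ ∈ posNN S true (body (renameRule Π k r))
          next  : Unfounded U (proj₁ occ , evalTs S M θ (proj₂ occ))

      module _ (em : ExcludedMiddle lzero) (SatComp : Sat S M (Comp S Π)) (U : Rels S M)
               (U≤I : _≤[_]_ S M U (predsΠ S Π) relI)
               (Π*U : ∀ ρ → evalF S M (withU S M U) ρ (star S (progFormula S Π))) where

        -- Only the type of step is needed below; unfolding its proof makes checking the descent explode.
        abstract
          step : (k : ℕ) (a : GroundAtom) → Unfounded U a → Step U k a
          step k (p , d) (p∈ , a , ¬Ua) = record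
            { r = r ; r∈Π = r∈Π ; θ = ρ' ; holds = holdsρ' ; head≡ = trans (cong (hd r ,_) argsρ') head≡
            ; occ = occ ; occ∈ = occ∈ ; next = q∈ , gap }
            where
            open Derivation (Comp-derivation SatComp p∈ a)
            open Block (k * blockWidth Π)

            B : Fm S
            B = rename free (body r)

            τ : ℕ → D
            τ = σ ∘ decode

            ¬B* : ¬ evalF S M (withU S M U) τ (star S B)
            ¬B* B* = ¬Ua (subst (λ (q , d) → U q d) head≡ (star-rule U Π*U r∈Π σ body*))
              where
              body* : evalF S M (withU S M U) σ (star S (body r))
              body* = Equivalence.to (evalF-rename-free M (withU S M U) (star S (body r)) σ)
                                     (subst (evalF S M (withU S M U) τ) (star-rename free (body r)) B*)

            preds-B : preds S B ⊆ predsΠ S Π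
            preds-B = preds-body⊆predsΠ Π r∈Π ∘ subst (_ ∈_) (preds-rename free (body r))

            holdsτ : evalF S M relI τ B
            holdsτ = Equivalence.from (evalF-rename-free M relI (body r) σ) holds

            open PositiveGap (positiveGap em U B τ (All.anti-mono preds-B U≤I) holdsτ ¬B*)

            holdsρ' : evalF S M relI ρ' B
            holdsρ' = evalF-cong relI B τ ρ' (λ w w∈ → sym (ρ'≈ρ w (fv-rename-free∉boundVars (body r) w∈))) holdsτ

            argsρ' : evalTs S M ρ' (renTs S free (args r)) ≡ evalTs S M σ (args r)
            argsρ' = trans (evalTs-cong (renTs S free (args r)) ρ' τ λ w w∈ →
                             let v , _ , w≡ = tsvars-renTs free (args r) w∈
                             in ρ'≈ρ w (subst (_∉ boundVars B) (sym w≡) (free∉boundVars-rename free (body r) v)))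
                           (evalTs-renTs-free M σ (args r))

            q∈ : proj₁ occ ∈ predsΠ S Π
            q∈ = preds-B (proj₁ (posNN-occursIn true B occ∈))

        module Descent (a₀ : Σ GroundAtom (Unfounded U)) where

          mutual
            atoms : ℕ → Σ GroundAtom (Unfounded U)
            atoms zero    = a₀
            atoms (suc k) = _ , Step.next (steps k)

            steps : (k : ℕ) → Step U k (proj₁ (atoms k))
            steps k = step k (proj₁ (atoms k)) (proj₂ (atoms k))

          rl : ℕ → Rule S
          rl k = renameRule Π k (Step.r (steps k))

          θ : ℕ → ℕ → D
          θ k = Step.θ (steps k)

          -- Every variable of rl k lies in block k, so a single assignment serves all rules of the walk.
          τ : ℕ → D
          τ w = θ (w / blockWidth Π) w

          τ≈θ : ∀ k {w} → w ∈ varsRule S (rl k) → τ w ≡ θ k w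
          τ≈θ k w∈ = cong (λ j → θ j _) (block-varsRule-renameRule Π k (Step.r∈Π (steps k)) w∈)

          label : (k : ℕ) → Σ[ s ∈ HeadArgs (hd (rl (suc k))) ] (hd (rl (suc k)) , s) ≡ Step.occ (steps k)
                            × tsvars S s ≡ tsvars S (proj₂ (Step.occ (steps k)))
                            × evalTs S M (θ k) s ≡ evalTs S M (θ (suc k)) (args (rl (suc k)))
          label k = relabel (Step.occ (steps k)) (θ k) (Step.head≡ (steps (suc k)))

          chain : (n : ℕ) → Chain S Π n
          chain n = record
            { rl = rl ∘ toℕ ; isV = λ i → renameRule-Vertex Π (toℕ i) (Step.r∈Π (steps (toℕ i)))
            ; lab = proj₁ ∘ label ∘ toℕ ; edge = edge ; apart = apart }
            where
            edge : (i : Fin n) → (hd (rl (suc (toℕ i))) , proj₁ (label (toℕ i))) ∈ posNN S true (body (rl (toℕ (inject₁ i))))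
            edge i rewrite toℕ-inject₁ i =
              subst (_∈ posNN S true (body (rl (toℕ i)))) (sym (proj₁ (proj₂ (label (toℕ i))))) (Step.occ∈ (steps (toℕ i)))

            apart : (i j : Fin (suc n)) → i ≢ j → (v : ℕ) → v ∈ varsRule S (rl (toℕ i)) → v ∈ varsRule S (rl (toℕ j)) → Empty
            apart i j i≢j v v∈i v∈j = i≢j (toℕ-injective (trans (sym (block i v∈i)) (block j v∈j)))
              where block = λ i → block-varsRule-renameRule Π (toℕ i) (Step.r∈Π (steps (toℕ i)))

          body-holds : ∀ k → evalF S M relI τ (body (rl k))
          body-holds k = evalF-cong relI (body (rl k)) (θ k) τ
                           (λ w w∈ → sym (τ≈θ k (∈-++⁺ʳ _ (fv⊆allvars (body (rl k)) w∈)))) (Step.holds (steps k))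

          label-holds : ∀ k → evalTs S M τ (proj₁ (label k)) ≡ evalTs S M τ (args (rl (suc k)))
          label-holds k with label k
          ... | s , _ , s-vars , s-eval = begin
            evalTs S M τ s                             ≡⟨ evalTs-cong s τ (θ k) (λ w → τ≈θ k ∘ ∈-++⁺ʳ _ ∘ occ-vars ∘ subst (w ∈_) s-vars) ⟩
            evalTs S M (θ k) s                         ≡⟨ s-eval ⟩
            evalTs S M (θ (suc k)) (args (rl (suc k))) ≡⟨ sym (evalTs-cong (args (rl (suc k))) τ (θ (suc k)) (λ w → τ≈θ (suc k) ∘ ∈-++⁺ˡ)) ⟩
            evalTs S M τ (args (rl (suc k)))           ∎
            where
            open ≡-Reasoning
            occ-vars = proj₂ (posNN-occursIn true (body (rl k)) (Step.occ∈ (steps k)))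

          chainFormula-holds : (n : ℕ) → evalF S M relI τ (chainFormula S (chain n))
          chainFormula-holds n = evalF-conj⁺ relI (L.concat (L.tabulate equations) ++ L.tabulate bodyAt) τ (All.++⁺
            (All.concat⁺ (All.tabulate⁺ {f = equations} λ i →
              evalF-eqsL⁺ relI (proj₁ (label (toℕ i))) (args (rl (suc (toℕ i)))) τ (label-holds (toℕ i))))
            (All.tabulate⁺ {f = bodyAt} (body-holds ∘ toℕ)))
            where
            equations : Fin n → List (Fm S)
            equations i = eqsL S (proj₁ (label (toℕ i))) (args (rl (suc (toℕ i))))

            bodyAt : Fin (suc n) → Fm S
            bodyAt i = body (rl (toℕ i))

      unfoundedAtom : ExcludedMiddle lzero → (U : Rels S M) → ¬ _≤[_]_ S M relI (predsΠ S Π) U → Σ GroundAtom (Unfounded U)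
      unfoundedAtom em U I≰U =
        let p , p∈ , ¬I⊆U = find (All.¬All⇒Any¬ (λ _ → em) (predsΠ S Π) I≰U)
            d , ¬[I→U]    = ¬∀⇒∃¬ em ¬I⊆U
            Ipd , ¬Upd    = ¬→⇒×¬ em ¬[I→U]
        in (p , d) , p∈ , Ipd , ¬Upd

      Comp⇒SM : ExcludedMiddle lzero → (Γ : Fm S → Set) → (∀ G → Γ G → Sat S M G) → Tight S Γ Π
              → Sat S M (Comp S Π) → SatSM S M (progFormula S Π)
      Comp⇒SM em Γ SatΓ (n , _ , tight) SatComp = Comp⇒Π SatComp , λ (U , U≤I , I≰U , Π*U) →
        let open Descent em SatComp U U≤I Π*U (unfoundedAtom em U I≰U)
            ¬chain = ¬ᶠ S (chainFormula S (chain n))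
        in evalF-foralls⁻ relI (dedupℕ (fv S ¬chain)) ¬chain τ (tight (chain n) M SatΓ SatComp τ) (chainFormula-holds n)

mainTheorem1 : (S : Signature) → ExcludedMiddle (lsuc lzero)
               → (Γ : Fm S → Set) → ((F : Fm S) → Γ F → Sentence S F)
               → (Π : Program S) → Tight S Γ Π
               → (M : Structure S) → ((F : Fm S) → Γ F → Sat S M F)
               → SatSM S M (progFormula S Π) ⇔ Sat S M (Comp S Π)
mainTheorem1 S em Γ _ Π tight M SatΓ = mk⇔ (SM⇒Comp S M Π em₀) (Comp⇒SM S M Π em₀ Γ SatΓ tight)
  where em₀ = excludedMiddle₀ em
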